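{- Let $r\in\mathbb N$ and let $\bm{\mathcal H_x},\bm{\mathcal H_y}$ be finite sets of vectors of $(r+1)$-vertex graphs (each with two distinguished vertices), with $t_x:=|\bm{\mathcal H_x}|$, $t_y:=|\bm{\mathcal H_y}|$. Let $\beta_x,\beta_y,\epsilon>0$. Suppose $G$ is a sufficiently large $n$-vertex graph, $x,y\in V(G)$, and there is $U\subseteq V(G)$ with $|U|\ge\epsilon n$ such that for every $z\in U$, $x$ and $z$ are $(\bm{\mathcal H_x};\beta_x)$-reachable and $z$ and $y$ are $(\bm{\mathcal H_y};\beta_y)$-reachable. Then $x$ and $y$ are $(\bm{\mathcal H_x}+\bm{\mathcal H_y};\beta)$-reachable with $\beta:=\frac{\epsilon\beta_x\beta_y}{2t_xt_y}$.
   Context: Given a vector $\bm H=(H^1,\dots,H^t)$ of $(r+1)$-vertex graphs, each with two distinguished vertices $w_1^i,w_2^i$, an $\bm H$-path is obtained by taking a copy of each $H^i$ and identifying $w_2^i$ with $w_1^{i+1}$ for $i\in[t-1]$; its endpoints are $w_1^1,w_2^t$. Two vertices $x,y$ of an $n$-vertex graph $G$ are $(\bm H;\beta)$-reachable if there are at least $\beta n^{tr-1}$ labelled embeddings of the $\bm H$-path in $G$ mapping its endpoints to $\{x,y\}$. For a set $\bm{\mathcal H}$ of such vectors, $x,y$ are $(\bm{\mathcal H};\beta)$-reachable if they are $(\bm H;\beta)$-reachable for some $\bm H\in\bm{\mathcal H}$. For sets of vectors $\bm{\mathcal H},\tilde{\bm{\mathcal H}}$, $\bm{\mathcal H}+\tilde{\bm{\mathcal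 H}}:=\bm{\mathcal H}\cup\tilde{\bm{\mathcal H}}\cup\{(H^1,\dots,H^t,\tilde H^1,\dots,\tilde H^{\tilde t}):(H^1,\dots,H^t)\in\bm{\mathcal H},(\tilde H^1,\dots,\tilde H^{\tilde t})\in\tilde{\bm{\mathcal H}}\}$ (concatenations).
   Formalization: The constants $\beta_x,\beta_y,\epsilon$ range over the positive rationals, so the constant β is rational as well. -}

module Defs where

open import Data.Nat as ℕ using (ℕ; zero; suc; _∸_; _^_)
open import Data.Integer using (+_)
open import Data.Rational as ℚ using (ℚ; _/_)
open import Data.Fin as Fin using (Fin; toℕ; splitAt)
open import Data.Fin.Subset using (Subset)
open import Data.List as List using (List; []; _∷_; allFin; concatMap)
open import Data.Nat.ListAction using (sum)
open import Data.Bool.ListAction using (and)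
open import Data.List.NonEmpty as List⁺ using (List⁺)
open import Data.Bool using (Bool; true; false; _∧_; _∨_; if_then_else_; not)
open import Data.Sum using (_⊎_; inj₁; inj₂; [_,_]′)
open import Relation.Nullary.Decidable using (⌊_⌋)
open import Relation.Binary.PropositionalEquality using (_≡_; _≢_)

record Graph (n : ℕ) : Set where
  field
    adj   : Fin n → Fin n → Bool
    sym   : ∀ i j → adj i j ≡ adj j i
    irrefl : ∀ i → adj i i ≡ false
open Graph public

record TPGraph (r : ℕ) : Set where
  field
    graph : Graph (suc r)
    w₁ w₂ : Fin (suc r)
    w₁≢w₂ : w₁ ≢ w₂
open TPGraph public

-- A vector H = (H¹,…,Hᵗ) of such graphs, t = suc len ≥ 1.
record HVec (r : ℕ) : Set where
  constructor hvec
  field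
    len    : ℕ
    graphs : Fin (suc len) → TPGraph r
open HVec public

tOf : ∀ {r} → HVec r → ℕ
tOf H = suc (len H)

concatH : ∀ {r} → HVec r → HVec r → HVec r
concatH (hvec k f) (hvec l g) = hvec (k ℕ.+ suc l) (λ i → [ f , g ]′ (splitAt (suc k) i))

-- 𝓗 + 𝓗̃ = 𝓗 ∪ 𝓗̃ ∪ {concatenations}
_⊕_ : ∀ {r} → List⁺ (HVec r) → List⁺ (HVec r) → List⁺ (HVec r)
Hs ⊕ Ks = Hs List⁺.⁺++⁺ (Ks List⁺.⁺++
  concatMap (λ H → List.map (concatH H) (List⁺.toList Ks)) (List⁺.toList Hs))

allFuns : ∀ {A : Set} (k : ℕ) → List A → List (Fin k → A)
allFuns zero    xs = (λ ()) ∷ []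
allFuns (suc k) xs =
  concatMap (λ a → List.map (λ f → λ { Fin.zero → a ; (Fin.suc i) → f i }) (allFuns k xs)) xs

∀F : ∀ {m} → (Fin m → Bool) → Bool
∀F P = and (List.map P (allFin _))

_==_ : ∀ {m} → Fin m → Fin m → Bool
a == b = ⌊ a Fin.≟ b ⌋

_==ℕ_ : ℕ → ℕ → Bool
a ==ℕ b = ⌊ a ℕ.≟ b ⌋

-- A labelled embedding of the H-path into G, written out on the copies:
-- φ i is the restriction of the embedding to the i-th copy of Hⁱ.
-- It is an embedding of the glued graph iff: each φ i is a homomorphism
-- of Hⁱ into G; w₂ⁱ and w₁ⁱ⁺¹ have the same image (gluing); and two
-- vertices of the disjoint union have the same image only if they are
-- equal or are glued (injectivity on the H-path).
isEmbedding : ∀ {r n} → Graph n → (H : HVec r) → Fin n → Fin n →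
              (Fin (tOf H) → Fin (suc r) → Fin n) → Bool
isEmbedding {r} {n} G (hvec k Hs) x y φ =
  hom ∧ glue ∧ inj ∧ ends
  where
  hom = ∀F λ i → ∀F λ u → ∀F λ v →
          not (adj (graph (Hs i)) u v) ∨ adj G (φ i u) (φ i v)
  glued : Fin (suc k) → Fin (suc r) → Fin (suc k) → Fin (suc r) → Bool
  glued i u j v = (toℕ j ==ℕ suc (toℕ i)) ∧ (u == w₂ (Hs i)) ∧ (v == w₁ (Hs j))
  glue = ∀F λ i → ∀F λ j →
          not (toℕ j ==ℕ suc (toℕ i)) ∨ (φ i (w₂ (Hs i)) == φ j (w₁ (Hs j)))
  inj = ∀F λ i → ∀F λ u → ∀F λ j → ∀F λ v →
          not (φ i u == φ j v) ∨ ((i == j) ∧ (u == v)) ∨ glued i u j v ∨ glued j v i u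
  ends = (φ Fin.zero (w₁ (Hs Fin.zero)) == x) ∧ (φ (Fin.fromℕ k) (w₂ (Hs (Fin.fromℕ k))) == y)

numEmb : ∀ {r n} → Graph n → HVec r → Fin n → Fin n → ℕ
numEmb {r} {n} G H x y =
  sum (List.map (λ φ → if isEmbedding G H x y φ then 1 else 0)
                (allFuns (tOf H) (allFuns (suc r) (allFin n))))

fromℕ : ℕ → ℚ
fromℕ m = + m / 1

-- 1/d (with the junk value 0 for d = 0, never used below)
inv : ℕ → ℚ
inv zero    = ℚ.0ℚ
inv (suc d) = + 1 / suc d

Reachable : ∀ {r n} → Graph n → HVec r → ℚ → Fin n → Fin n → Set
Reachable {r} {n} G H β x y =
  β ℚ.* fromℕ (n ^ (tOf H ℕ.* r ∸ 1)) ℚ.≤ fromℕ (numEmb G H x y)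

open import Data.Product using (Σ; _×_)
open import Data.List.Membership.Propositional using (_∈_)
ReachableSet : ∀ {r n} → Graph n → List⁺ (HVec r) → ℚ → Fin n → Fin n → Set
ReachableSet G 𝓗 β x y = Σ _ λ H → (H ∈ List⁺.toList 𝓗) × Reachable G H β x y

{-# OPTIONS --safe #-}
module Submission where

-- Pigeonhole gives one pair (H, K) ∈ 𝓗x × 𝓗y witnessing both reachabilities for at least |U|/(tₓ t_y)
-- vertices z; summing over them, there are at least εβₓβ_y n^(a+b+1)/(tₓ t_y) pairs (φ₁, φ₂) of an
-- embedded H-path from x to z and an embedded K-path from z to y, where a = t_H r - 1, b = t_K r - 1.
-- If φ₂ meets φ₁ only in z, the pair is an embedding of the concatenated path, which determines z.
-- Otherwise a vertex of φ₂ coincides with a vertex of φ₁. For a fixed position of this collision two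
-- more vertices of the two paths are prescribed, so there are at most n^(a+b) such pairs: count all
-- maps of consecutively glued copies, ignoring edges and injectivity, where every prescribed vertex
-- costs a factor n. As there are boundedly many positions, for large n at most half of the pairs collide.

open import Defs hiding (sym)
open import Data.Nat using (ℕ; NonZero)

module Sums where

  open import Data.Nat using (ℕ; zero; suc; _+_; _*_; _≤_; _≤?_; z≤n)
  open import Data.Nat.Properties
  open import Data.Fin as F using (Fin; zero; suc)
  open import Data.List using (List; []; _∷_; _++_; map; concatMap; allFin; length)
  open import Data.List.Properties using (length-tabulate; map-tabulate)
  open import Data.List.Membership.Propositional using (_∈_)
  open import Data.List.Relation.Unary.Any using (here; there)
  open import Data.Nat.ListAction using (sum)
  open import Data.Bool using (Bool; true; false; if_then_else_)
  open import Data.Product using (∃; _×_; _,_)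
  open import Relation.Nullary using (yes; no)
  open import Relation.Binary.PropositionalEquality
  open import Algebra.Properties.CommutativeSemigroup +-commutativeSemigroup
    using () renaming (interchange to +-interchange)
  open import Algebra.Properties.CommutativeSemigroup *-commutativeSemigroup
    using () renaming (xy∙z≈xz∙y to *-right-comm; interchange to *-interchange)

  private
    variable
      A B : Set

  𝟙 : Bool → ℕ
  𝟙 b = if b then 1 else 0

  ∑ : {A : Set} → List A → (A → ℕ) → ℕ
  ∑ []       f = 0
  ∑ (a ∷ as) f = f a + ∑ as f

  sum-map≡∑ : (xs : List A) (f : A → ℕ) → sum (map f xs) ≡ ∑ xs f
  sum-map≡∑ []       f = refl
  sum-map≡∑ (a ∷ xs) f = cong (f a +_) (sum-map≡∑ xs f)

  ∑-cong : (xs : List A) {f g : A → ℕ} → (∀ a → f a ≡ g a) → ∑ xs f ≡ ∑ xs g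
  ∑-cong []       f≡g = refl
  ∑-cong (a ∷ xs) f≡g = cong₂ _+_ (f≡g a) (∑-cong xs f≡g)

  ∑-mono : (xs : List A) {f g : A → ℕ} → (∀ a → f a ≤ g a) → ∑ xs f ≤ ∑ xs g
  ∑-mono []       f≤g = z≤n
  ∑-mono (a ∷ xs) f≤g = +-mono-≤ (f≤g a) (∑-mono xs f≤g)

  ∑-zero : (xs : List A) → ∑ xs (λ _ → 0) ≡ 0
  ∑-zero []       = refl
  ∑-zero (_ ∷ xs) = ∑-zero xs

  ∑-++ : (xs ys : List A) (f : A → ℕ) → ∑ (xs ++ ys) f ≡ ∑ xs f + ∑ ys f
  ∑-++ []       ys f = refl
  ∑-++ (a ∷ xs) ys f = trans (cong (f a +_) (∑-++ xs ys f)) (sym (+-assoc (f a) _ _))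

  ∑-map : (xs : List A) (h : A → B) (f : B → ℕ) → ∑ (map h xs) f ≡ ∑ xs (λ a → f (h a))
  ∑-map []       h f = refl
  ∑-map (a ∷ xs) h f = cong (f (h a) +_) (∑-map xs h f)

  ∑-concatMap : (xs : List A) (g : A → List B) (f : B → ℕ) →
    ∑ (concatMap g xs) f ≡ ∑ xs (λ a → ∑ (g a) f)
  ∑-concatMap []       g f = refl
  ∑-concatMap (a ∷ xs) g f = trans (∑-++ (g a) _ f) (cong (∑ (g a) f +_) (∑-concatMap xs g f))

  ∑-+ : (xs : List A) (f g : A → ℕ) → ∑ xs (λ a → f a + g a) ≡ ∑ xs f + ∑ xs g
  ∑-+ []       f g = refl
  ∑-+ (a ∷ xs) f g = trans (cong (f a + g a +_) (∑-+ xs f g)) (+-interchange (f a) (g a) _ _)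

  ∑-*ˡ : (xs : List A) (c : ℕ) (f : A → ℕ) → ∑ xs (λ a → c * f a) ≡ c * ∑ xs f
  ∑-*ˡ []       c f = sym (*-zeroʳ c)
  ∑-*ˡ (a ∷ xs) c f = trans (cong (c * f a +_) (∑-*ˡ xs c f)) (sym (*-distribˡ-+ c (f a) _))

  ∑-*ʳ : (xs : List A) (c : ℕ) (f : A → ℕ) → ∑ xs (λ a → f a * c) ≡ ∑ xs f * c
  ∑-*ʳ xs c f = trans (∑-cong xs (λ a → *-comm (f a) c)) (trans (∑-*ˡ xs c f) (*-comm c _))

  ∑-comm : (xs : List A) (ys : List B) (f : A → B → ℕ) →
    ∑ xs (λ a → ∑ ys (f a)) ≡ ∑ ys (λ b → ∑ xs (λ a → f a b))
  ∑-comm []       ys f = sym (∑-zero ys)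
  ∑-comm (a ∷ xs) ys f = trans (cong (∑ ys (f a) +_) (∑-comm xs ys f)) (sym (∑-+ ys (f a) _))

  ∑≤length* : (xs : List A) (f : A → ℕ) (c : ℕ) → (∀ a → f a ≤ c) → ∑ xs f ≤ length xs * c
  ∑≤length* []       f c f≤c = z≤n
  ∑≤length* (a ∷ xs) f c f≤c = +-mono-≤ (f≤c a) (∑≤length* xs f c f≤c)

  ∑-const : (xs : List A) (c : ℕ) → ∑ xs (λ _ → c) ≡ length xs * c
  ∑-const []       c = refl
  ∑-const (a ∷ xs) c = cong (c +_) (∑-const xs c)

  ∈⇒≤∑ : {x : A} {xs : List A} (f : A → ℕ) → x ∈ xs → f x ≤ ∑ xs f
  ∈⇒≤∑ {xs = a ∷ xs} f (here refl) = m≤m+n (f a) _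
  ∈⇒≤∑ {xs = a ∷ xs} f (there x∈) = ≤-trans (∈⇒≤∑ f x∈) (m≤n+m _ (f a))

  pigeonhole : (a : A) (as : List A) (f : A → ℕ) →
    ∃ λ b → b ∈ (a ∷ as) × ∑ (a ∷ as) f ≤ length (a ∷ as) * f b
  pigeonhole a [] f = a , here refl , ≤-refl
  pigeonhole a (a′ ∷ as) f with pigeonhole a′ as f
  ... | b , b∈ , ∑≤ with f a ≤? f b
  ...   | yes fa≤fb = b , there b∈ , +-mono-≤ fa≤fb ∑≤
  ...   | no  fa≰fb = a , here refl , +-monoʳ-≤ (f a) (≤-trans ∑≤ (*-monoʳ-≤ (length (a′ ∷ as)) (<⇒≤ (≰⇒> fa≰fb))))

  ∑-*-≤ : (xs : List A) (g h : A → ℕ) {X Y B C : ℕ} →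
    (∀ a → h a * X ≤ B) → ∑ xs g * Y ≤ C → ∑ xs (λ a → g a * h a) * X * Y ≤ C * B
  ∑-*-≤ xs g h {X} {Y} {B} {C} hX≤B gY≤C = begin
    ∑ xs (λ a → g a * h a) * X * Y  ≡⟨ cong (_* Y) (∑-*ʳ xs X _) ⟨
    ∑ xs (λ a → g a * h a * X) * Y  ≤⟨ *-monoˡ-≤ Y (∑-mono xs (λ a →
                                         ≤-trans (≤-reflexive (*-assoc (g a) (h a) X)) (*-monoʳ-≤ (g a) (hX≤B a)))) ⟩
    ∑ xs (λ a → g a * B) * Y        ≡⟨ cong (_* Y) (∑-*ʳ xs B g) ⟩
    ∑ xs g * B * Y                  ≡⟨ *-right-comm (∑ xs g) B Y ⟩
    ∑ xs g * Y * B                  ≤⟨ *-monoˡ-≤ B gY≤C ⟩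
    C * B                           ∎
    where open ≤-Reasoning

  ∑𝟙*≤∑* : (xs : List A) (s : A → Bool) (f g : A → ℕ) {X Y P Q : ℕ} →
    (∀ a → s a ≡ true → X ≤ f a * P) → (∀ a → s a ≡ true → Y ≤ g a * Q) →
    ∑ xs (λ a → 𝟙 (s a)) * X * Y ≤ ∑ xs (λ a → f a * g a) * (P * Q)
  ∑𝟙*≤∑* xs s f g {X} {Y} {P} {Q} X≤fP Y≤gQ = begin
      ∑ xs (λ a → 𝟙 (s a)) * X * Y
    ≡⟨ trans (*-assoc (∑ xs (λ a → 𝟙 (s a))) X Y) (sym (∑-*ʳ xs (X * Y) (λ a → 𝟙 (s a)))) ⟩
      ∑ xs (λ a → 𝟙 (s a) * (X * Y))
    ≤⟨ ∑-mono xs (λ a → selected a (s a) refl) ⟩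
      ∑ xs (λ a → f a * g a * (P * Q))
    ≡⟨ ∑-*ʳ xs (P * Q) (λ a → f a * g a) ⟩
      ∑ xs (λ a → f a * g a) * (P * Q)
    ∎
    where
    open ≤-Reasoning
    selected : ∀ a b → s a ≡ b → 𝟙 b * (X * Y) ≤ f a * g a * (P * Q)
    selected a false _   = z≤n
    selected a true  s≡t = begin
      X * Y + 0               ≡⟨ +-identityʳ (X * Y) ⟩
      X * Y                   ≤⟨ *-mono-≤ (X≤fP a s≡t) (Y≤gQ a s≡t) ⟩
      f a * P * (g a * Q)     ≡⟨ *-interchange (f a) P (g a) Q ⟩
      f a * g a * (P * Q)     ∎

  ∑Fin : (m : ℕ) → (Fin m → ℕ) → ℕ
  ∑Fin m = ∑ (allFin m)

  ∑Fin-suc : (m : ℕ) (h : Fin (suc m) → ℕ) → ∑Fin (suc m) h ≡ h zero + ∑Fin m (λ i → h (suc i))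
  ∑Fin-suc m h = cong (h zero +_)
    (trans (cong (λ xs → ∑ xs h) (sym (map-tabulate (λ i → i) suc))) (∑-map (allFin m) suc h))

  length-allFin : ∀ n → length (allFin n) ≡ n
  length-allFin n = length-tabulate (λ i → i)

module BooleanTests where

  open Sums
  open import Data.Nat using (ℕ; suc; _+_; _*_; _≤_; z≤n; s≤s)
  open import Data.Nat.Properties
  open import Data.Fin as F using (Fin)
  open import Data.List using (List; []; _∷_; map; allFin)
  open import Data.List.Properties using (map-cong)
  open import Data.List.Membership.Propositional using (_∈_)
  open import Data.List.Membership.Propositional.Properties using (∈-allFin)
  open import Data.List.Relation.Unary.Any using (here; there)
  open import Data.Bool using (Bool; true; false; _∧_; _∨_; not)
  open import Data.Bool.ListAction using (and)
  open import Data.Product using (_×_; _,_; proj₁; proj₂)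
  open import Data.Sum using (_⊎_; inj₁; inj₂)
  open import Relation.Nullary using (yes; no; contradiction)
  open import Relation.Binary.PropositionalEquality

  private
    variable
      A : Set
      m k₁ k₂ k₃ k₄ : ℕ
      a b : Fin m

  ==-refl : (a : Fin m) → (a == a) ≡ true
  ==-refl a with a F.≟ a
  ... | yes _   = refl
  ... | no  a≢a = contradiction refl a≢a

  ==⇒≡ : (a == b) ≡ true → a ≡ b
  ==⇒≡ {a = a} {b} a==b with a F.≟ b
  ... | yes a≡b = a≡b

  ≢⇒==false : a ≢ b → (a == b) ≡ false
  ≢⇒==false {a = a} {b} a≢b with a F.≟ b
  ... | yes a≡b = contradiction a≡b a≢b
  ... | no  _   = refl

  ≡⇒==true : a ≡ b → (a == b) ≡ true
  ≡⇒==true {a = a} refl = ==-refl a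

  ==-suc : (a b : Fin m) → (Fin.suc a == Fin.suc b) ≡ (a == b)
  ==-suc a b with a F.≟ b
  ... | yes _ = refl
  ... | no  _ = refl

  ==ℕ⇒≡ : {i j : ℕ} → (i ==ℕ j) ≡ true → i ≡ j
  ==ℕ⇒≡ {i} {j} i==j with i ≟ j
  ... | yes i≡j = i≡j

  ≡⇒==ℕtrue : {i j : ℕ} → i ≡ j → (i ==ℕ j) ≡ true
  ≡⇒==ℕtrue {i} {j} i≡j with i ≟ j
  ... | yes _   = refl
  ... | no  i≢j = contradiction i≡j i≢j

  ∧-true : ∀ {p q} → (p ∧ q) ≡ true → (p ≡ true) × (q ≡ true)
  ∧-true {true} {true} _ = refl , refl

  ∧-intro : ∀ {p q} → p ≡ true → q ≡ true → (p ∧ q) ≡ true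
  ∧-intro refl refl = refl

  ∨-true : ∀ {p q} → (p ∨ q) ≡ true → (p ≡ true) ⊎ (q ≡ true)
  ∨-true {true}  _   = inj₁ refl
  ∨-true {false} q≡t = inj₂ q≡t

  ∨-introˡ : ∀ {p} q → p ≡ true → (p ∨ q) ≡ true
  ∨-introˡ q refl = refl

  ∨-introʳ : ∀ p {q} → q ≡ true → (p ∨ q) ≡ true
  ∨-introʳ true  _   = refl
  ∨-introʳ false q≡t = q≡t

  not∨-elim : ∀ {p q} → (not p ∨ q) ≡ true → p ≡ true → q ≡ true
  not∨-elim {true} q≡t refl = q≡t

  not∨-intro : ∀ {p q} → (p ≡ true → q ≡ true) → (not p ∨ q) ≡ true
  not∨-intro {false} _   = refl
  not∨-intro {true}  p⇒q = p⇒q refl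

  𝟙-∧ : ∀ p q → 𝟙 (p ∧ q) ≡ 𝟙 p * 𝟙 q
  𝟙-∧ true  q = sym (+-identityʳ (𝟙 q))
  𝟙-∧ false q = refl

  𝟙-true : ∀ {p} → p ≡ true → 𝟙 p ≡ 1
  𝟙-true refl = refl

  𝟙-≡ : a ≡ b → 𝟙 (a == b) ≡ 1
  𝟙-≡ a≡b = 𝟙-true (≡⇒==true a≡b)

  𝟙≤ : ∀ p {c} → (p ≡ true → 1 ≤ c) → 𝟙 p ≤ c
  𝟙≤ false _  = z≤n
  𝟙≤ true  1≤c = 1≤c refl

  𝟙*𝟙*≤ : ∀ p q {x c} → (p ≡ true → q ≡ true → x ≤ c) → 𝟙 p * 𝟙 q * x ≤ c
  𝟙*𝟙*≤ false q      _ = z≤n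
  𝟙*𝟙*≤ true  false  _ = z≤n
  𝟙*𝟙*≤ true  true {x} x≤c = ≤-trans (≤-reflexive (+-identityʳ x)) (x≤c refl refl)

  *-one : ∀ {i j} → i ≡ 1 → j ≡ 1 → i * j ≡ 1
  *-one refl refl = refl

  module _ (P : A → Bool) where

    and-map-intro : (xs : List A) → (∀ a → P a ≡ true) → and (map P xs) ≡ true
    and-map-intro []       _  = refl
    and-map-intro (a ∷ xs) Ps = ∧-intro (Ps a) (and-map-intro xs Ps)

    and-map-elim : {xs : List A} {a : A} → and (map P xs) ≡ true → a ∈ xs → P a ≡ true
    and-map-elim all (here refl) = proj₁ (∧-true all)
    and-map-elim all (there a∈) = and-map-elim (proj₂ (∧-true all)) a∈

    𝟙-not-and-map : (xs : List A) → 𝟙 (not (and (map P xs))) ≤ ∑ xs (λ a → 𝟙 (not (P a)))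
    𝟙-not-and-map []       = z≤n
    𝟙-not-and-map (a ∷ xs) with P a
    ... | true  = 𝟙-not-and-map xs
    ... | false = s≤s z≤n

  ∀F-intro : (P : Fin m → Bool) → (∀ i → P i ≡ true) → ∀F P ≡ true
  ∀F-intro P = and-map-intro P (allFin _)

  ∀F-elim : (P : Fin m → Bool) → ∀F P ≡ true → ∀ i → P i ≡ true
  ∀F-elim P all i = and-map-elim P all (∈-allFin i)

  ∀F-cong : {P Q : Fin m → Bool} → (∀ i → P i ≡ Q i) → ∀F P ≡ ∀F Q
  ∀F-cong P≡Q = cong and (map-cong P≡Q (allFin _))

  𝟙-not-∀F : (P : Fin m → Bool) → 𝟙 (not (∀F P)) ≤ ∑Fin m (λ i → 𝟙 (not (P i)))
  𝟙-not-∀F P = 𝟙-not-and-map P (allFin _)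


  ∀F₂-elim : (P : Fin k₁ → Fin k₂ → Bool) → (∀F λ i → ∀F (P i)) ≡ true → ∀ i j → P i j ≡ true
  ∀F₂-elim P all i = ∀F-elim (P i) (∀F-elim (λ i → ∀F (P i)) all i)

  ∀F₃-elim : (P : Fin k₁ → Fin k₂ → Fin k₃ → Bool) → (∀F λ i → ∀F λ j → ∀F (P i j)) ≡ true →
    ∀ i j k → P i j k ≡ true
  ∀F₃-elim P all i = ∀F₂-elim (P i) (∀F-elim (λ i → ∀F λ j → ∀F (P i j)) all i)

  ∀F₄-elim : (P : Fin k₁ → Fin k₂ → Fin k₃ → Fin k₄ → Bool) → (∀F λ i → ∀F λ j → ∀F λ k → ∀F (P i j k)) ≡ true →
    ∀ i j k l → P i j k l ≡ true
  ∀F₄-elim P all i = ∀F₃-elim (P i) (∀F-elim (λ i → ∀F λ j → ∀F λ k → ∀F (P i j k)) all i)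

  ∀F₂-intro : (P : Fin k₁ → Fin k₂ → Bool) → (∀ i j → P i j ≡ true) → (∀F λ i → ∀F (P i)) ≡ true
  ∀F₂-intro P Ps = ∀F-intro (λ i → ∀F (P i)) (λ i → ∀F-intro (P i) (Ps i))

  ∀F₃-intro : (P : Fin k₁ → Fin k₂ → Fin k₃ → Bool) → (∀ i j k → P i j k ≡ true) →
    (∀F λ i → ∀F λ j → ∀F (P i j)) ≡ true
  ∀F₃-intro P Ps = ∀F-intro (λ i → ∀F λ j → ∀F (P i j)) (λ i → ∀F₂-intro (P i) (Ps i))

  ∀F₄-intro : (P : Fin k₁ → Fin k₂ → Fin k₃ → Fin k₄ → Bool) → (∀ i j k l → P i j k l ≡ true) →
    (∀F λ i → ∀F λ j → ∀F λ k → ∀F (P i j k)) ≡ true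
  ∀F₄-intro P Ps = ∀F-intro (λ i → ∀F λ j → ∀F λ k → ∀F (P i j k)) (λ i → ∀F₃-intro (P i) (Ps i))

  ∀F₂-cong : {P Q : Fin k₁ → Fin k₂ → Bool} → (∀ i j → P i j ≡ Q i j) → (∀F λ i → ∀F (P i)) ≡ (∀F λ i → ∀F (Q i))
  ∀F₂-cong P≡Q = ∀F-cong (λ i → ∀F-cong (P≡Q i))

  ∀F₃-cong : {P Q : Fin k₁ → Fin k₂ → Fin k₃ → Bool} → (∀ i j k → P i j k ≡ Q i j k) →
    (∀F λ i → ∀F λ j → ∀F (P i j)) ≡ (∀F λ i → ∀F λ j → ∀F (Q i j))
  ∀F₃-cong P≡Q = ∀F-cong (λ i → ∀F₂-cong (P≡Q i))

  ∀F₄-cong : {P Q : Fin k₁ → Fin k₂ → Fin k₃ → Fin k₄ → Bool} → (∀ i j k l → P i j k l ≡ Q i j k l) →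
    (∀F λ i → ∀F λ j → ∀F λ k → ∀F (P i j k)) ≡ (∀F λ i → ∀F λ j → ∀F λ k → ∀F (Q i j k))
  ∀F₄-cong P≡Q = ∀F-cong (λ i → ∀F₃-cong (P≡Q i))

  𝟙-not-∀F₄ : (P : Fin k₁ → Fin k₂ → Fin k₃ → Fin k₄ → Bool) →
    𝟙 (not (∀F λ i → ∀F λ j → ∀F λ k → ∀F (P i j k)))
    ≤ ∑Fin k₁ λ i → ∑Fin k₂ λ j → ∑Fin k₃ λ k → ∑Fin k₄ λ l → 𝟙 (not (P i j k l))
  𝟙-not-∀F₄ P = ≤-trans (𝟙-not-∀F (λ i → ∀F λ j → ∀F λ k → ∀F (P i j k))) (∑-mono (allFin _) λ i →
    ≤-trans (𝟙-not-∀F (λ j → ∀F λ k → ∀F (P i j k))) (∑-mono (allFin _) λ j →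
    ≤-trans (𝟙-not-∀F (λ k → ∀F (P i j k))) (∑-mono (allFin _) λ k → 𝟙-not-∀F (P i j k))))

  *𝟙-split : ∀ x p → x ≡ x * 𝟙 p + x * 𝟙 (not p)
  *𝟙-split x true  = trans (sym (*-identityʳ x)) (sym (trans (cong (x * 1 +_) (*-zeroʳ x)) (+-identityʳ (x * 1))))
  *𝟙-split x false = trans (sym (*-identityʳ x)) (cong (_+ x * 1) (sym (*-zeroʳ x)))

module FunctionCounts where

  open Sums
  open BooleanTests
  open import Data.Nat using (ℕ; NonZero; zero; suc; _+_; _*_; _^_; _≤_; z≤n)
  open import Data.Nat.Properties
  open import Data.Nat.Tactic.RingSolver using (solve-∀)
  open import Data.Fin as F using (Fin; zero; suc; splitAt)
  open import Data.List using (List; []; _∷_; allFin; length)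
  open import Data.Maybe using (Maybe; just; nothing)
  open import Data.Bool using (Bool; true; false; _∧_; if_then_else_)
  open import Data.Product using (_×_; _,_; proj₁; proj₂)
  open import Data.Sum using (inj₁; inj₂; [_,_]′)
  open import Data.Unit using (⊤)
  open import Relation.Binary.PropositionalEquality
  open import Function using (_∘_)

  private
    variable
      A : Set
      k m n : ℕ

  cons : A → (Fin k → A) → Fin (suc k) → A
  cons a f zero    = a
  cons a f (suc i) = f i

  append : (m : ℕ) {l : ℕ} → (Fin m → A) → (Fin l → A) → Fin (m + l) → A
  append m f g i = [ f , g ]′ (splitAt m i)

  -- Without function extensionality, sums over allFuns can only be re-indexed for summands that
  -- respect pointwise equality of functions.
  Extensional : ((Fin k → A) → ℕ) → Set
  Extensional {k = k} {A = A} F = {f g : Fin k → A} → (∀ i → f i ≡ g i) → F f ≡ F g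

  ∑-allFuns-suc : (k : ℕ) (xs : List A) (F : (Fin (suc k) → A) → ℕ) → Extensional F →
    ∑ (allFuns (suc k) xs) F ≡ ∑ xs (λ a → ∑ (allFuns k xs) (λ f → F (cons a f)))
  ∑-allFuns-suc k xs F ext = trans (∑-concatMap xs _ F) (∑-cong xs (λ a →
    trans (∑-map (allFuns k xs) _ F) (∑-cong (allFuns k xs) (λ f → ext (λ { zero → refl ; (suc i) → refl })))))

  cons-cong : (a : A) {f g : Fin k → A} → (∀ i → f i ≡ g i) → ∀ i → cons a f i ≡ cons a g i
  cons-cong a f≗g zero    = refl
  cons-cong a f≗g (suc i) = f≗g i

  append-congˡ : (m : ℕ) {l : ℕ} {f f′ : Fin m → A} (g : Fin l → A) → (∀ i → f i ≡ f′ i) →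
    ∀ i → append m f g i ≡ append m f′ g i
  append-congˡ m g f≗f′ i with splitAt m i
  ... | inj₁ j = f≗f′ j
  ... | inj₂ j = refl

  append-cons : (m : ℕ) {l : ℕ} (a : A) (f : Fin m → A) (g : Fin l → A) →
    ∀ i → append (suc m) (cons a f) g i ≡ cons a (append m f g) i
  append-cons m a f g zero = refl
  append-cons m a f g (suc i) with splitAt m i
  ... | inj₁ j = refl
  ... | inj₂ j = refl

  ∑-allFuns-+ : (m l : ℕ) (xs : List A) (F : (Fin (m + l) → A) → ℕ) → Extensional F →
    ∑ (allFuns (m + l) xs) F ≡ ∑ (allFuns m xs) (λ f → ∑ (allFuns l xs) (λ g → F (append m f g)))
  ∑-allFuns-+ zero l xs F ext = sym (trans (+-identityʳ _) (∑-cong (allFuns l xs) (λ g → ext (λ i → refl))))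
  ∑-allFuns-+ (suc m) l xs F ext = begin
      ∑ (allFuns (suc m + l) xs) F
    ≡⟨ ∑-allFuns-suc (m + l) xs F ext ⟩
      ∑ xs (λ a → ∑ (allFuns (m + l) xs) (λ h → F (cons a h)))
    ≡⟨ ∑-cong xs (λ a → ∑-allFuns-+ m l xs (λ h → F (cons a h)) (λ e → ext (cons-cong a e))) ⟩
      ∑ xs (λ a → ∑ (allFuns m xs) (λ f → ∑ (allFuns l xs) (λ g → F (cons a (append m f g)))))
    ≡⟨ ∑-cong xs (λ a → ∑-cong (allFuns m xs) (λ f → ∑-cong (allFuns l xs) (λ g →
         ext (λ i → sym (append-cons m a f g i))))) ⟩
      ∑ xs (λ a → ∑ (allFuns m xs) (λ f → ∑ (allFuns l xs) (λ g → F (append (suc m) (cons a f) g))))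
    ≡⟨ ∑-allFuns-suc m xs _ (λ e → ∑-cong (allFuns l xs) (λ g → ext (append-congˡ (suc m) g e))) ⟨
      ∑ (allFuns (suc m) xs) (λ f → ∑ (allFuns l xs) (λ g → F (append (suc m) f g)))
    ∎
    where open ≡-Reasoning

  Extensional-* : {F G : (Fin k → A) → ℕ} → Extensional F → Extensional G → Extensional (λ f → F f * G f)
  Extensional-* F-ext G-ext f≗g = cong₂ _*_ (F-ext f≗g) (G-ext f≗g)

  agrees : Maybe (Fin n) → Fin n → Bool
  agrees nothing  _ = true
  agrees (just c) v = v == c

  isDefined : Maybe (Fin n) → ℕ
  isDefined nothing  = 0
  isDefined (just _) = 1

  𝟙-agreesAll : (m : ℕ) → (Fin m → Maybe (Fin n)) → (Fin m → Fin n) → ℕ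
  𝟙-agreesAll zero    σ ψ = 1
  𝟙-agreesAll (suc m) σ ψ = 𝟙 (agrees (σ zero) (ψ zero)) * 𝟙-agreesAll m (σ ∘ suc) (ψ ∘ suc)

  𝟙-agreesAll-ext : (m : ℕ) (σ : Fin m → Maybe (Fin n)) → Extensional (𝟙-agreesAll m σ)
  𝟙-agreesAll-ext zero    σ e = refl
  𝟙-agreesAll-ext (suc m) σ e = cong₂ (λ a b → 𝟙 (agrees (σ zero) a) * b) (e zero)
    (𝟙-agreesAll-ext m (λ i → σ (suc i)) (λ i → e (suc i)))

  ∣dom∣ : (m : ℕ) → (Fin m → Maybe (Fin n)) → ℕ
  ∣dom∣ m σ = ∑Fin m (λ u → isDefined (σ u))

  ∑Fin-𝟙== : (n : ℕ) (c : Fin n) (g : Fin n → ℕ) → ∑Fin n (λ u → 𝟙 (u == c) * g u) ≡ g c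
  ∑Fin-𝟙== (suc n) zero g = trans (∑Fin-suc n (λ u → 𝟙 (u == zero) * g u))
    (trans (cong (1 * g zero +_) (∑-zero (allFin n))) (trans (+-identityʳ _) (*-identityˡ _)))
  ∑Fin-𝟙== (suc n) (suc c) g = trans (∑Fin-suc n (λ u → 𝟙 (u == suc c) * g u))
    (trans (∑-cong (allFin n) (λ i → cong (λ b → 𝟙 b * g (suc i)) (==-suc i c))) (∑Fin-𝟙== n c (λ i → g (suc i))))

  ∑Fin-𝟙==≡1 : (n : ℕ) (c : Fin n) → ∑Fin n (λ u → 𝟙 (u == c)) ≡ 1
  ∑Fin-𝟙==≡1 n c = trans (∑-cong (allFin n) (λ u → sym (*-identityʳ (𝟙 (u == c))))) (∑Fin-𝟙== n c (λ _ → 1))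

  ∑-agrees*n^isDefined : (n : ℕ) (s : Maybe (Fin n)) → ∑Fin n (λ a → 𝟙 (agrees s a)) * n ^ isDefined s ≡ n
  ∑-agrees*n^isDefined n nothing  =
    trans (*-identityʳ _) (trans (∑-const (allFin n) 1) (trans (*-identityʳ _) (length-allFin n)))
  ∑-agrees*n^isDefined n (just c) =
    trans (cong (_* (n * 1)) (∑Fin-𝟙==≡1 n c)) (trans (*-identityˡ _) (*-identityʳ n))

  ∑-agreesAll*n^∣dom∣ : (n m : ℕ) (σ : Fin m → Maybe (Fin n)) →
    ∑ (allFuns m (allFin n)) (𝟙-agreesAll m σ) * n ^ ∣dom∣ m σ ≡ n ^ m
  ∑-agreesAll*n^∣dom∣ n zero    σ = refl
  ∑-agreesAll*n^∣dom∣ n (suc m) σ = begin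
      ∑ (allFuns (suc m) (allFin n)) (𝟙-agreesAll (suc m) σ) * n ^ ∣dom∣ (suc m) σ
    ≡⟨ cong₂ (λ a b → a * n ^ b) (∑-allFuns-suc m (allFin n) _ (𝟙-agreesAll-ext (suc m) σ))
                                   (∑Fin-suc m (λ u → isDefined (σ u))) ⟩
      ∑Fin n (λ a → ∑ fs (λ f → 𝟙 (agrees (σ zero) a) * 𝟙-agreesAll m σ′ f)) * n ^ (d₀ + ∣dom∣ m σ′)
    ≡⟨ cong (_* n ^ (d₀ + ∣dom∣ m σ′)) (trans (∑-cong (allFin n) (λ a → ∑-*ˡ fs (𝟙 (agrees (σ zero) a)) (𝟙-agreesAll m σ′)))
                                         (∑-*ʳ (allFin n) S (λ a → 𝟙 (agrees (σ zero) a)))) ⟩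
      (A₀ * S) * n ^ (d₀ + ∣dom∣ m σ′)
    ≡⟨ cong ((A₀ * S) *_) (^-distribˡ-+-* n d₀ (∣dom∣ m σ′)) ⟩
      (A₀ * S) * (n ^ d₀ * n ^ ∣dom∣ m σ′)
    ≡⟨ interchange A₀ S (n ^ d₀) (n ^ ∣dom∣ m σ′) ⟩
      (A₀ * n ^ d₀) * (S * n ^ ∣dom∣ m σ′)
    ≡⟨ cong₂ _*_ (∑-agrees*n^isDefined n (σ zero)) (∑-agreesAll*n^∣dom∣ n m σ′) ⟩
      n * n ^ m
    ∎
    where
    open ≡-Reasoning
    σ′ = λ i → σ (suc i)
    fs = allFuns m (allFin n)
    d₀ = isDefined (σ zero)
    S  = ∑ fs (𝟙-agreesAll m σ′)
    A₀ = ∑Fin n (λ a → 𝟙 (agrees (σ zero) a))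
    interchange : ∀ a s p q → (a * s) * (p * q) ≡ (a * p) * (s * q)
    interchange = solve-∀

  assignment : List (Fin m × Fin n) → Fin m → Maybe (Fin n)
  assignment []             u = nothing
  assignment ((p , c) ∷ ps) u = if u == p then just c else assignment ps u

  satisfies : List (Fin m × Fin n) → (Fin m → Fin n) → Bool
  satisfies []             ψ = true
  satisfies ((p , c) ∷ ps) ψ = (ψ p == c) ∧ satisfies ps ψ

  DistinctPositions : List (Fin m × Fin n) → Set
  DistinctPositions []             = ⊤
  DistinctPositions ((p , c) ∷ ps) = (assignment ps p ≡ nothing) × DistinctPositions ps

  satisfies⇒agrees : (ps : List (Fin m × Fin n)) (ψ : Fin m → Fin n) → satisfies ps ψ ≡ true →
    ∀ u → agrees (assignment ps u) (ψ u) ≡ true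
  satisfies⇒agrees []             ψ _   u = refl
  satisfies⇒agrees ((p , c) ∷ ps) ψ sat u with u == p in u==p
  ... | true rewrite ==⇒≡ u==p = proj₁ (∧-true sat)
  ... | false = satisfies⇒agrees ps ψ (proj₂ (∧-true sat)) u

  𝟙-agreesAll≡1 : (m : ℕ) (σ : Fin m → Maybe (Fin n)) (ψ : Fin m → Fin n) →
    (∀ u → agrees (σ u) (ψ u) ≡ true) → 𝟙-agreesAll m σ ψ ≡ 1
  𝟙-agreesAll≡1 zero    σ ψ _  = refl
  𝟙-agreesAll≡1 (suc m) σ ψ ag rewrite ag zero =
    trans (+-identityʳ _) (𝟙-agreesAll≡1 m (λ i → σ (suc i)) (λ i → ψ (suc i)) (λ i → ag (suc i)))

  𝟙-satisfies≤𝟙-agreesAll : (ps : List (Fin m × Fin n)) (ψ : Fin m → Fin n) →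
    𝟙 (satisfies ps ψ) ≤ 𝟙-agreesAll m (assignment ps) ψ
  𝟙-satisfies≤𝟙-agreesAll {m = m} ps ψ with satisfies ps ψ in sat
  ... | false = z≤n
  ... | true  = ≤-reflexive (sym (𝟙-agreesAll≡1 m (assignment ps) ψ (satisfies⇒agrees ps ψ sat)))

  isDefined-step : (p : Fin m) (c : Fin n) (ps : List (Fin m × Fin n)) → assignment ps p ≡ nothing →
    ∀ u → 𝟙 (u == p) + isDefined (assignment ps u) ≤ isDefined (assignment ((p , c) ∷ ps) u)
  isDefined-step p c ps fresh u with u == p in u==p
  ... | true rewrite ==⇒≡ u==p | fresh = ≤-refl
  ... | false = ≤-refl

  length≤∣dom∣ : (ps : List (Fin m × Fin n)) → DistinctPositions ps → length ps ≤ ∣dom∣ m (assignment ps)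
  length≤∣dom∣ []                       _            = z≤n
  length≤∣dom∣ {m = m} ((p , c) ∷ ps) (fresh , ds) = begin
      suc (length ps)
    ≡⟨ cong (_+ length ps) (∑Fin-𝟙==≡1 m p) ⟨
      ∑Fin m (λ u → 𝟙 (u == p)) + length ps
    ≤⟨ +-monoʳ-≤ (∑Fin m (λ u → 𝟙 (u == p))) (length≤∣dom∣ ps ds) ⟩
      ∑Fin m (λ u → 𝟙 (u == p)) + ∣dom∣ m (assignment ps)
    ≡⟨ ∑-+ (allFin m) (λ u → 𝟙 (u == p)) (λ u → isDefined (assignment ps u)) ⟨
      ∑Fin m (λ u → 𝟙 (u == p) + isDefined (assignment ps u))
    ≤⟨ ∑-mono (allFin m) (isDefined-step p c ps fresh) ⟩
      ∣dom∣ m (assignment ((p , c) ∷ ps))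
    ∎
    where open ≤-Reasoning

  ∑-satisfies*n^length≤n^m : (n m : ℕ) .{{_ : NonZero n}} (ps : List (Fin m × Fin n)) → DistinctPositions ps →
    ∑ (allFuns m (allFin n)) (λ ψ → 𝟙 (satisfies ps ψ)) * n ^ length ps ≤ n ^ m
  ∑-satisfies*n^length≤n^m n m ps ds = begin
      ∑ (allFuns m (allFin n)) (λ ψ → 𝟙 (satisfies ps ψ)) * n ^ length ps
    ≤⟨ *-mono-≤ (∑-mono (allFuns m (allFin n)) (𝟙-satisfies≤𝟙-agreesAll ps))
                (^-monoʳ-≤ n (length≤∣dom∣ ps ds)) ⟩
      ∑ (allFuns m (allFin n)) (𝟙-agreesAll m (assignment ps)) * n ^ ∣dom∣ m (assignment ps)
    ≡⟨ ∑-agreesAll*n^∣dom∣ n m (assignment ps) ⟩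
      n ^ m
    ∎
    where open ≤-Reasoning

module Chains (r n : ℕ) {{_ : NonZero n}} where

  open Sums
  open BooleanTests
  open FunctionCounts
  open import Data.Nat using (zero; suc; _+_; _*_; _^_; _≤_; z≤n)
  open import Data.Nat.Properties
  open import Data.Nat.Tactic.RingSolver using (solve-∀)
  open import Data.Fin as F using (Fin; zero; suc)
  open import Data.List using (List; []; _∷_; allFin; length)
  open import Data.Bool using (true; false)
  open import Data.Product using (_×_; _,_)
  open import Data.Unit using (tt)
  open import Data.Maybe using (nothing)
  open import Relation.Nullary using (¬_; yes; no)
  open import Relation.Binary.PropositionalEquality
  open import Function using (_∘_)
  open import Algebra.Properties.CommutativeSemigroup *-commutativeSemigroup using (xy∙z≈xz∙y)

  CopyMap : Set
  CopyMap = Fin (suc r) → Fin n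

  copyMaps : List CopyMap
  copyMaps = allFuns (suc r) (allFin n)

  chainMaps : (k : ℕ) → List (Fin (suc k) → CopyMap)
  chainMaps k = allFuns (suc k) copyMaps

  copyMaps-fixing : (ps : List (Fin (suc r) × Fin n)) → DistinctPositions ps → (j : ℕ) → length ps ≡ suc j →
    ∑ copyMaps (λ ψ → 𝟙 (satisfies ps ψ)) * n ^ j ≤ n ^ r
  copyMaps-fixing ps ds j ∣ps∣≡1+j = *-cancelˡ-≤ n (begin
      n * (S * n ^ j)   ≡⟨ x*[y*z]≡y*[x*z] n S (n ^ j) ⟩
      S * n ^ suc j     ≡⟨ cong (λ l → S * n ^ l) ∣ps∣≡1+j ⟨
      S * n ^ length ps ≤⟨ ∑-satisfies*n^length≤n^m n (suc r) ps ds ⟩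
      n ^ suc r         ∎)
    where
    open ≤-Reasoning
    S = ∑ copyMaps (λ ψ → 𝟙 (satisfies ps ψ))
    x*[y*z]≡y*[x*z] : ∀ x y z → x * (y * z) ≡ y * (x * z)
    x*[y*z]≡y*[x*z] = solve-∀

  copyMaps-fixing₁ : (w : Fin (suc r)) (a : Fin n) → ∑ copyMaps (λ ψ → 𝟙 (ψ w == a)) * n ^ 0 ≤ n ^ r
  copyMaps-fixing₁ w a = subst (λ S → S * n ^ 0 ≤ n ^ r)
    (∑-cong copyMaps (λ ψ → trans (𝟙-∧ (ψ w == a) true) (*-identityʳ _)))
    (copyMaps-fixing ((w , a) ∷ []) (refl , tt) 0 refl)

  copyMaps-fixing₂ : (w v : Fin (suc r)) (a c : Fin n) → w ≢ v →
    ∑ copyMaps (λ ψ → 𝟙 (ψ w == a) * 𝟙 (ψ v == c)) * n ^ 1 ≤ n ^ r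
  copyMaps-fixing₂ w v a c w≢v = subst (λ S → S * n ^ 1 ≤ n ^ r)
    (∑-cong copyMaps (λ ψ → trans (𝟙-∧ (ψ w == a) _)
      (cong (𝟙 (ψ w == a) *_) (trans (𝟙-∧ (ψ v == c) true) (*-identityʳ _)))))
    (copyMaps-fixing ((w , a) ∷ (v , c) ∷ []) (fresh , refl , tt) 1 refl)
    where
    fresh : assignment ((v , c) ∷ []) w ≡ nothing
    fresh rewrite ≢⇒==false w≢v = refl

  copyMaps-fixing₃ : (w w′ v : Fin (suc r)) (a b c : Fin n) → w ≢ w′ → w ≢ v → w′ ≢ v →
    ∑ copyMaps (λ ψ → 𝟙 (ψ w == a) * 𝟙 (ψ w′ == b) * 𝟙 (ψ v == c)) * n ^ 2 ≤ n ^ r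
  copyMaps-fixing₃ w w′ v a b c w≢w′ w≢v w′≢v = subst (λ S → S * n ^ 2 ≤ n ^ r)
    (∑-cong copyMaps (λ ψ → trans (𝟙-∧ (ψ w == a) _) (trans (cong (𝟙 (ψ w == a) *_) (trans (𝟙-∧ (ψ w′ == b) _)
       (cong (𝟙 (ψ w′ == b) *_) (trans (𝟙-∧ (ψ v == c) true) (*-identityʳ _)))))
       (sym (*-assoc (𝟙 (ψ w == a)) _ _)))))
    (copyMaps-fixing ((w , a) ∷ (w′ , b) ∷ (v , c) ∷ []) (fresh₁ , fresh₂ , refl , tt) 2 refl)
    where
    fresh₁ : assignment ((w′ , b) ∷ (v , c) ∷ []) w ≡ nothing
    fresh₁ rewrite ≢⇒==false w≢w′ | ≢⇒==false w≢v = refl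
    fresh₂ : assignment ((v , c) ∷ []) w′ ≡ nothing
    fresh₂ rewrite ≢⇒==false w′≢v = refl

  -- Only the start vertex and the gluing of consecutive copies are kept from isEmbedding.
  𝟙-chainFrom : (k : ℕ) → (Fin (suc k) → TPGraph r) → Fin n → (Fin (suc k) → CopyMap) → ℕ
  𝟙-chainFrom zero    Hs a φ = 𝟙 (φ zero (w₁ (Hs zero)) == a)
  𝟙-chainFrom (suc k) Hs a φ =
    𝟙 (φ zero (w₁ (Hs zero)) == a) * 𝟙-chainFrom k (Hs ∘ suc) (φ zero (w₂ (Hs zero))) (φ ∘ suc)

  𝟙-endsAt : (k : ℕ) → (Fin (suc k) → TPGraph r) → Fin n → (Fin (suc k) → CopyMap) → ℕ
  𝟙-endsAt k Hs b φ = 𝟙 (φ (F.fromℕ k) (w₂ (Hs (F.fromℕ k))) == b)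

  𝟙-at-ext : ∀ {k} (j : Fin k) (v : Fin (suc r)) (c : Fin n) →
    Extensional (λ (φ : Fin k → CopyMap) → 𝟙 (φ j v == c))
  𝟙-at-ext j v c φ≗φ′ = cong (λ ψ → 𝟙 (ψ v == c)) (φ≗φ′ j)

  𝟙-chainFrom-ext : ∀ k Hs a → Extensional (𝟙-chainFrom k Hs a)
  𝟙-chainFrom-ext zero    Hs a φ≗φ′ = 𝟙-at-ext zero (w₁ (Hs zero)) a φ≗φ′
  𝟙-chainFrom-ext (suc k) Hs a {φ} φ≗φ′ = cong₂ _*_ (𝟙-at-ext zero (w₁ (Hs zero)) a φ≗φ′)
    (trans (cong (λ b → 𝟙-chainFrom k (Hs ∘ suc) b (φ ∘ suc)) (cong (λ ψ → ψ (w₂ (Hs zero))) (φ≗φ′ zero)))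
           (𝟙-chainFrom-ext k (Hs ∘ suc) _ (φ≗φ′ ∘ suc)))

  𝟙-chainFrom-≢ : ∀ k Hs b φ → (φ zero (w₁ (Hs zero)) == b) ≡ false → 𝟙-chainFrom k Hs b φ ≡ 0
  𝟙-chainFrom-≢ zero    Hs b φ ≢b rewrite ≢b = refl
  𝟙-chainFrom-≢ (suc k) Hs b φ ≢b rewrite ≢b = refl

  𝟙-chainFrom-*-start : ∀ k Hs b φ c →
    𝟙-chainFrom k Hs b φ * 𝟙 (φ zero (w₁ (Hs zero)) == c) ≤ 𝟙 (b == c) * 𝟙-chainFrom k Hs b φ
  𝟙-chainFrom-*-start k Hs b φ c with φ zero (w₁ (Hs zero)) == b in start==b
  ... | false rewrite 𝟙-chainFrom-≢ k Hs b φ start==b = z≤n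
  ... | true  rewrite ==⇒≡ start==b = ≤-reflexive (*-comm (𝟙-chainFrom k Hs b φ) _)

  chain-base : (F : (Fin 1 → CopyMap) → ℕ) → Extensional F → (g : CopyMap → ℕ) (j : ℕ) →
    (∀ ψ φ → F (cons ψ φ) ≤ g ψ) → ∑ copyMaps g * n ^ j ≤ n ^ r →
    ∑ (chainMaps 0) F * n ^ j ≤ n ^ (1 * r)
  chain-base F F-ext g j F≤g g-bound = begin
      ∑ (chainMaps 0) F * n ^ j
    ≡⟨ cong (_* n ^ j) (∑-allFuns-suc 0 copyMaps F F-ext) ⟩
      ∑ copyMaps (λ ψ → ∑ (allFuns 0 copyMaps) (λ φ → F (cons ψ φ))) * n ^ j
    ≤⟨ *-monoˡ-≤ (n ^ j) (∑-mono copyMaps (λ ψ → ≤-trans (≤-reflexive (+-identityʳ _)) (F≤g ψ _))) ⟩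
      ∑ copyMaps g * n ^ j
    ≤⟨ g-bound ⟩
      n ^ r
    ≡⟨ cong (n ^_) (+-identityʳ r) ⟨
      n ^ (1 * r)
    ∎
    where open ≤-Reasoning

  chain-step : (k : ℕ) (F : (Fin (suc (suc k)) → CopyMap) → ℕ) → Extensional F →
    (g : CopyMap → ℕ) (h : CopyMap → (Fin (suc k) → CopyMap) → ℕ) (j₁ j₂ : ℕ) →
    (∀ ψ φ → F (cons ψ φ) ≤ g ψ * h ψ φ) →
    (∀ ψ → ∑ (chainMaps k) (h ψ) * n ^ j₁ ≤ n ^ (suc k * r)) →
    ∑ copyMaps g * n ^ j₂ ≤ n ^ r →
    ∑ (chainMaps (suc k)) F * n ^ (j₁ + j₂) ≤ n ^ (suc (suc k) * r)
  chain-step k F F-ext g h j₁ j₂ F≤gh h-bound g-bound = begin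
      ∑ (chainMaps (suc k)) F * n ^ (j₁ + j₂)
    ≡⟨ cong₂ _*_ (∑-allFuns-suc (suc k) copyMaps F F-ext) (^-distribˡ-+-* n j₁ j₂) ⟩
      ∑ copyMaps (λ ψ → ∑ (chainMaps k) (λ φ → F (cons ψ φ))) * (n ^ j₁ * n ^ j₂)
    ≤⟨ *-monoˡ-≤ (n ^ j₁ * n ^ j₂) (∑-mono copyMaps (λ ψ → ≤-trans (∑-mono (chainMaps k) (F≤gh ψ))
                                               (≤-reflexive (∑-*ˡ (chainMaps k) (g ψ) (h ψ))))) ⟩
      ∑ copyMaps (λ ψ → g ψ * ∑ (chainMaps k) (h ψ)) * (n ^ j₁ * n ^ j₂)
    ≡⟨ *-assoc (∑ copyMaps (λ ψ → g ψ * ∑ (chainMaps k) (h ψ))) (n ^ j₁) (n ^ j₂) ⟨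
      ∑ copyMaps (λ ψ → g ψ * ∑ (chainMaps k) (h ψ)) * n ^ j₁ * n ^ j₂
    ≤⟨ ∑-*-≤ copyMaps g (λ ψ → ∑ (chainMaps k) (h ψ)) h-bound g-bound ⟩
      n ^ r * n ^ (suc k * r)
    ≡⟨ ^-distribˡ-+-* n r (suc k * r) ⟨
      n ^ (suc (suc k) * r)
    ∎
    where open ≤-Reasoning

  ∑-chainFrom : ∀ k Hs a → ∑ (chainMaps k) (𝟙-chainFrom k Hs a) * n ^ 0 ≤ n ^ (suc k * r)
  ∑-chainFrom zero    Hs a = chain-base _ (𝟙-chainFrom-ext 0 Hs a) (λ ψ → 𝟙 (ψ (w₁ (Hs zero)) == a)) 0
    (λ ψ φ → ≤-refl) (copyMaps-fixing₁ (w₁ (Hs zero)) a)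
  ∑-chainFrom (suc k) Hs a = chain-step k _ (𝟙-chainFrom-ext (suc k) Hs a)
    (λ ψ → 𝟙 (ψ (w₁ (Hs zero)) == a)) (λ ψ → 𝟙-chainFrom k (Hs ∘ suc) (ψ (w₂ (Hs zero)))) 0 0
    (λ ψ φ → ≤-refl) (λ ψ → ∑-chainFrom k (Hs ∘ suc) (ψ (w₂ (Hs zero)))) (copyMaps-fixing₁ (w₁ (Hs zero)) a)

  IsStart : ∀ {k} → (Fin (suc k) → TPGraph r) → Fin (suc k) → Fin (suc r) → Set
  IsStart Hs j v = j ≡ zero × v ≡ w₁ (Hs zero)

  -- The start of copy 1 is glued to the end of copy 0, so fixing it fixes a vertex of copy 0.
  ∑-chainFrom-through-glued : ∀ k Hs a c →
    ∑ (chainMaps (suc k)) (λ φ → 𝟙-chainFrom (suc k) Hs a φ * 𝟙 (φ (suc zero) (w₁ (Hs (suc zero))) == c)) * n ^ 1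
    ≤ n ^ (suc (suc k) * r)
  ∑-chainFrom-through-glued k Hs a c = chain-step k _
    (Extensional-* (𝟙-chainFrom-ext (suc k) Hs a) (𝟙-at-ext (suc zero) (w₁ (Hs (suc zero))) c))
    (λ ψ → 𝟙 (ψ (w₁ (Hs zero)) == a) * 𝟙 (ψ (w₂ (Hs zero)) == c))
    (λ ψ → 𝟙-chainFrom k (Hs ∘ suc) (ψ (w₂ (Hs zero)))) 0 1
    (λ ψ φ → let s = 𝟙 (ψ (w₁ (Hs zero)) == a); b = ψ (w₂ (Hs zero)) in begin
        s * 𝟙-chainFrom k (Hs ∘ suc) b φ * 𝟙 (φ zero (w₁ (Hs (suc zero))) == c)
      ≡⟨ *-assoc s _ _ ⟩
        s * (𝟙-chainFrom k (Hs ∘ suc) b φ * 𝟙 (φ zero (w₁ (Hs (suc zero))) == c))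
      ≤⟨ *-monoʳ-≤ s (𝟙-chainFrom-*-start k (Hs ∘ suc) b φ c) ⟩
        s * (𝟙 (b == c) * 𝟙-chainFrom k (Hs ∘ suc) b φ)
      ≡⟨ *-assoc s _ _ ⟨
        s * 𝟙 (b == c) * 𝟙-chainFrom k (Hs ∘ suc) b φ
      ∎)
    (λ ψ → ∑-chainFrom k (Hs ∘ suc) (ψ (w₂ (Hs zero))))
    (copyMaps-fixing₂ (w₁ (Hs zero)) (w₂ (Hs zero)) a c (w₁≢w₂ (Hs zero)))
    where open ≤-Reasoning

  ∑-chainFrom-through-later : ∀ k Hs a j v c → ¬ IsStart (Hs ∘ suc) j v →
    ∑ (chainMaps (suc k)) (λ φ → 𝟙-chainFrom (suc k) Hs a φ * 𝟙 (φ (suc j) v == c)) * n ^ 1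
    ≤ n ^ (suc (suc k) * r)

  ∑-chainFrom-through : ∀ k Hs a j v c → ¬ IsStart Hs j v →
    ∑ (chainMaps k) (λ φ → 𝟙-chainFrom k Hs a φ * 𝟙 (φ j v == c)) * n ^ 1 ≤ n ^ (suc k * r)
  ∑-chainFrom-through zero Hs a zero v c ¬start =
    chain-base _ (Extensional-* (𝟙-chainFrom-ext 0 Hs a) (𝟙-at-ext zero v c))
      (λ ψ → 𝟙 (ψ (w₁ (Hs zero)) == a) * 𝟙 (ψ v == c)) 1 (λ ψ φ → ≤-refl)
      (copyMaps-fixing₂ (w₁ (Hs zero)) v a c (λ w₁≡v → ¬start (refl , sym w₁≡v)))
  ∑-chainFrom-through (suc k) Hs a zero v c ¬start =
    chain-step k _ (Extensional-* (𝟙-chainFrom-ext (suc k) Hs a) (𝟙-at-ext zero v c))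
      (λ ψ → 𝟙 (ψ (w₁ (Hs zero)) == a) * 𝟙 (ψ v == c)) (λ ψ → 𝟙-chainFrom k (Hs ∘ suc) (ψ (w₂ (Hs zero)))) 0 1
      (λ ψ φ → ≤-reflexive (xy∙z≈xz∙y (𝟙 (ψ (w₁ (Hs zero)) == a)) _ (𝟙 (ψ v == c))))
      (λ ψ → ∑-chainFrom k (Hs ∘ suc) (ψ (w₂ (Hs zero))))
      (copyMaps-fixing₂ (w₁ (Hs zero)) v a c (λ w₁≡v → ¬start (refl , sym w₁≡v)))
  ∑-chainFrom-through (suc k) Hs a (suc j) v c _ with j F.≟ zero | v F.≟ w₁ (Hs (suc zero))
  ... | yes refl | yes refl = ∑-chainFrom-through-glued k Hs a c
  ... | yes refl | no v≢w₁  = ∑-chainFrom-through-later k Hs a zero v c (λ (_ , v≡w₁) → v≢w₁ v≡w₁)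
  ... | no j≢0   | _        = ∑-chainFrom-through-later k Hs a j v c (λ (j≡0 , _) → j≢0 j≡0)

  ∑-chainFrom-through-later k Hs a j v c ¬start =
    chain-step k _ (Extensional-* (𝟙-chainFrom-ext (suc k) Hs a) (𝟙-at-ext (suc j) v c))
      (λ ψ → 𝟙 (ψ (w₁ (Hs zero)) == a)) (λ ψ φ → 𝟙-chainFrom k (Hs ∘ suc) (ψ (w₂ (Hs zero))) φ * 𝟙 (φ j v == c)) 1 0
      (λ ψ φ → ≤-reflexive (*-assoc (𝟙 (ψ (w₁ (Hs zero)) == a)) _ _))
      (λ ψ → ∑-chainFrom-through k (Hs ∘ suc) (ψ (w₂ (Hs zero))) j v c ¬start)
      (copyMaps-fixing₁ (w₁ (Hs zero)) a)

  IsEnd : ∀ {k} → (Fin (suc k) → TPGraph r) → Fin (suc k) → Fin (suc r) → Set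
  IsEnd {k} Hs j v = j ≡ F.fromℕ k × v ≡ w₂ (Hs (F.fromℕ k))

  ∑-chainFrom-to : ∀ k Hs a b →
    ∑ (chainMaps k) (λ φ → 𝟙-chainFrom k Hs a φ * 𝟙-endsAt k Hs b φ) * n ^ 1 ≤ n ^ (suc k * r)
  ∑-chainFrom-to k Hs a b = ∑-chainFrom-through k Hs a (F.fromℕ k) (w₂ (Hs (F.fromℕ k))) b end≢start
    where
    end≢start : ¬ IsStart Hs (F.fromℕ k) (w₂ (Hs (F.fromℕ k)))
    end≢start (last≡0 , w₂≡w₁) = w₁≢w₂ (Hs zero) (sym (trans (cong (λ i → w₂ (Hs i)) (sym last≡0)) w₂≡w₁))

  ∑-chainFrom-to-through : ∀ k Hs a b j v c → v ≢ w₁ (Hs j) → ¬ IsEnd Hs j v →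
    ∑ (chainMaps k) (λ φ → 𝟙-chainFrom k Hs a φ * 𝟙-endsAt k Hs b φ * 𝟙 (φ j v == c)) * n ^ 2
    ≤ n ^ (suc k * r)
  ∑-chainFrom-to-through zero Hs a b zero v c v≢w₁ ¬end =
    chain-base _ (Extensional-* (Extensional-* (𝟙-chainFrom-ext 0 Hs a) (𝟙-at-ext zero (w₂ (Hs zero)) b))
                                (𝟙-at-ext zero v c))
      (λ ψ → 𝟙 (ψ (w₁ (Hs zero)) == a) * 𝟙 (ψ (w₂ (Hs zero)) == b) * 𝟙 (ψ v == c)) 2 (λ ψ φ → ≤-refl)
      (copyMaps-fixing₃ (w₁ (Hs zero)) (w₂ (Hs zero)) v a b c
        (w₁≢w₂ (Hs zero)) (λ w₁≡v → v≢w₁ (sym w₁≡v)) (λ w₂≡v → ¬end (refl , sym w₂≡v)))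
  ∑-chainFrom-to-through (suc k) Hs a b zero v c v≢w₁ ¬end =
    chain-step k _ (Extensional-* (Extensional-* (𝟙-chainFrom-ext (suc k) Hs a) (𝟙-at-ext (F.fromℕ (suc k)) _ b))
                                  (𝟙-at-ext zero v c))
      (λ ψ → 𝟙 (ψ (w₁ (Hs zero)) == a) * 𝟙 (ψ v == c))
      (λ ψ φ → 𝟙-chainFrom k (Hs ∘ suc) (ψ (w₂ (Hs zero))) φ * 𝟙-endsAt k (Hs ∘ suc) b φ) 1 1
      (λ ψ φ → ≤-reflexive (xyzw≡xw[yz] (𝟙 (ψ (w₁ (Hs zero)) == a)) _ _ (𝟙 (ψ v == c))))
      (λ ψ → ∑-chainFrom-to k (Hs ∘ suc) (ψ (w₂ (Hs zero))) b)
      (copyMaps-fixing₂ (w₁ (Hs zero)) v a c (λ w₁≡v → v≢w₁ (sym w₁≡v)))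
    where
    xyzw≡xw[yz] : ∀ x y z w → x * y * z * w ≡ x * w * (y * z)
    xyzw≡xw[yz] = solve-∀
  ∑-chainFrom-to-through (suc k) Hs a b (suc j) v c v≢w₁ ¬end =
    chain-step k _ (Extensional-* (Extensional-* (𝟙-chainFrom-ext (suc k) Hs a) (𝟙-at-ext (F.fromℕ (suc k)) _ b))
                                  (𝟙-at-ext (suc j) v c))
      (λ ψ → 𝟙 (ψ (w₁ (Hs zero)) == a))
      (λ ψ φ → 𝟙-chainFrom k (Hs ∘ suc) (ψ (w₂ (Hs zero))) φ * 𝟙-endsAt k (Hs ∘ suc) b φ * 𝟙 (φ j v == c)) 2 0
      (λ ψ φ → ≤-reflexive (xyzw≡x[yzw] (𝟙 (ψ (w₁ (Hs zero)) == a)) _ _ _))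
      (λ ψ → ∑-chainFrom-to-through k (Hs ∘ suc) (ψ (w₂ (Hs zero))) b j v c v≢w₁
               (λ (j≡last , v≡w₂) → ¬end (cong suc j≡last , v≡w₂)))
      (copyMaps-fixing₁ (w₁ (Hs zero)) a)
    where
    xyzw≡x[yzw] : ∀ x y z w → x * y * z * w ≡ x * (y * z * w)
    xyzw≡x[yzw] = solve-∀

module Embeddings where

  open Sums
  open BooleanTests
  open FunctionCounts
  open import Data.Nat using (ℕ; zero; suc)
  open import Data.Fin as F using (Fin; zero; suc; toℕ)
  open import Data.Bool using (Bool; true; _∧_; _∨_; not)
  open import Data.Product using (_×_; _,_; proj₁; proj₂)
  open import Data.Sum using (_⊎_; inj₁; inj₂)
  open import Relation.Binary.PropositionalEquality

  private
    variable
      r n k : ℕ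

  Glued : (Fin (suc k) → TPGraph r) → Fin (suc k) → Fin (suc r) → Fin (suc k) → Fin (suc r) → Set
  Glued Hs i u j v = toℕ j ≡ suc (toℕ i) × u ≡ w₂ (Hs i) × v ≡ w₁ (Hs j)

  record IsEmbedding (G : Graph n) (Hs : Fin (suc k) → TPGraph r) (x y : Fin n)
                     (φ : Fin (suc k) → Fin (suc r) → Fin n) : Set where
    field
      hom   : ∀ i u v → adj (graph (Hs i)) u v ≡ true → adj G (φ i u) (φ i v) ≡ true
      glue  : ∀ i j → toℕ j ≡ suc (toℕ i) → φ i (w₂ (Hs i)) ≡ φ j (w₁ (Hs j))
      inj   : ∀ i u j v → φ i u ≡ φ j v → (i ≡ j × u ≡ v) ⊎ Glued Hs i u j v ⊎ Glued Hs j v i u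
      start : φ zero (w₁ (Hs zero)) ≡ x
      end   : φ (F.fromℕ k) (w₂ (Hs (F.fromℕ k))) ≡ y

  module _ (Hs : Fin (suc k) → TPGraph r) where

    gluedTest : Fin (suc k) → Fin (suc r) → Fin (suc k) → Fin (suc r) → Bool
    gluedTest i u j v = (toℕ j ==ℕ suc (toℕ i)) ∧ (u == w₂ (Hs i)) ∧ (v == w₁ (Hs j))

    gluedTest⇒Glued : ∀ i u j v → gluedTest i u j v ≡ true → Glued Hs i u j v
    gluedTest⇒Glued i u j v glued with ∧-true glued
    ... | j≡1+i , rest with ∧-true rest
    ... | u≡w₂ , v≡w₁ = ==ℕ⇒≡ j≡1+i , ==⇒≡ u≡w₂ , ==⇒≡ v≡w₁

    Glued⇒gluedTest : ∀ i u j v → Glued Hs i u j v → gluedTest i u j v ≡ true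
    Glued⇒gluedTest i u j v (j≡1+i , refl , refl) =
      ∧-intro (≡⇒==ℕtrue j≡1+i) (∧-intro (==-refl (w₂ (Hs i))) (==-refl (w₁ (Hs j))))

    module _ (φ : Fin (suc k) → Fin (suc r) → Fin n) where

      homTest : Graph n → Fin (suc k) → Fin (suc r) → Fin (suc r) → Bool
      homTest G i u v = not (adj (graph (Hs i)) u v) ∨ adj G (φ i u) (φ i v)

      glueTest : Fin (suc k) → Fin (suc k) → Bool
      glueTest i j = not (toℕ j ==ℕ suc (toℕ i)) ∨ (φ i (w₂ (Hs i)) == φ j (w₁ (Hs j)))

      injTest : Fin (suc k) → Fin (suc r) → Fin (suc k) → Fin (suc r) → Bool
      injTest i u j v = not (φ i u == φ j v) ∨ ((i == j) ∧ (u == v)) ∨ gluedTest i u j v ∨ gluedTest j v i u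

      injTest-cases : ∀ i u j v → (((i == j) ∧ (u == v)) ∨ gluedTest i u j v ∨ gluedTest j v i u) ≡ true →
        (i ≡ j × u ≡ v) ⊎ Glued Hs i u j v ⊎ Glued Hs j v i u
      injTest-cases i u j v cases with ∨-true cases
      ... | inj₁ same = inj₁ (==⇒≡ (proj₁ (∧-true same)) , ==⇒≡ (proj₂ (∧-true same)))
      ... | inj₂ glued with ∨-true glued
      ...   | inj₁ ij = inj₂ (inj₁ (gluedTest⇒Glued i u j v ij))
      ...   | inj₂ ji = inj₂ (inj₂ (gluedTest⇒Glued j v i u ji))

      injTest-intro : ∀ i u j v → (i ≡ j × u ≡ v) ⊎ Glued Hs i u j v ⊎ Glued Hs j v i u →
        (((i == j) ∧ (u == v)) ∨ gluedTest i u j v ∨ gluedTest j v i u) ≡ true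
      injTest-intro i u j v (inj₁ (refl , refl)) = ∨-introˡ _ (∧-intro (==-refl i) (==-refl u))
      injTest-intro i u j v (inj₂ (inj₁ ij)) = ∨-introʳ ((i == j) ∧ (u == v)) (∨-introˡ _ (Glued⇒gluedTest i u j v ij))
      injTest-intro i u j v (inj₂ (inj₂ ji)) = ∨-introʳ ((i == j) ∧ (u == v)) (∨-introʳ _ (Glued⇒gluedTest j v i u ji))

  isEmbedding⇒IsEmbedding : (G : Graph n) (Hs : Fin (suc k) → TPGraph r) (x y : Fin n) (φ : Fin (suc k) → Fin (suc r) → Fin n) →
    isEmbedding G (hvec k Hs) x y φ ≡ true → IsEmbedding G Hs x y φ
  isEmbedding⇒IsEmbedding G Hs x y φ emb with ∧-true emb
  ... | homs , rest with ∧-true rest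
  ... | glues , rest′ with ∧-true rest′
  ... | injs , ends with ∧-true ends
  ... | start , end = record
    { hom   = λ i u v → not∨-elim (∀F₃-elim (homTest Hs φ G) homs i u v)
    ; glue  = λ i j j≡1+i → ==⇒≡ (not∨-elim (∀F₂-elim (glueTest Hs φ) glues i j) (≡⇒==ℕtrue j≡1+i))
    ; inj   = λ i u j v φiu≡φjv →
        injTest-cases Hs φ i u j v (not∨-elim (∀F₄-elim (injTest Hs φ) injs i u j v) (≡⇒==true φiu≡φjv))
    ; start = ==⇒≡ start
    ; end   = ==⇒≡ end
    }

  IsEmbedding⇒isEmbedding : (G : Graph n) (Hs : Fin (suc k) → TPGraph r) (x y : Fin n) (φ : Fin (suc k) → Fin (suc r) → Fin n) →
    IsEmbedding G Hs x y φ → isEmbedding G (hvec k Hs) x y φ ≡ true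
  IsEmbedding⇒isEmbedding G Hs x y φ emb =
    ∧-intro (∀F₃-intro (homTest Hs φ G) (λ i u v → not∨-intro (hom i u v)))
    (∧-intro (∀F₂-intro (glueTest Hs φ) (λ i j → not∨-intro (λ j==1+i → ≡⇒==true (glue i j (==ℕ⇒≡ j==1+i)))))
    (∧-intro (∀F₄-intro (injTest Hs φ) (λ i u j v →
                not∨-intro (λ φiu==φjv → injTest-intro Hs φ i u j v (inj i u j v (==⇒≡ φiu==φjv)))))
    (∧-intro (≡⇒==true start) (≡⇒==true end))))
    where open IsEmbedding emb

  𝟙-isEmbedding-ext : (G : Graph n) (Hs : Fin (suc k) → TPGraph r) (x y : Fin n) →
    Extensional (λ φ → 𝟙 (isEmbedding G (hvec k Hs) x y φ))
  𝟙-isEmbedding-ext {k = k} G Hs x y {φ} {φ′} φ≗φ′ = cong 𝟙 (cong₂ _∧_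
      (∀F₃-cong homs) (cong₂ _∧_ (∀F₂-cong glues) (cong₂ _∧_ (∀F₄-cong injs)
      (cong₂ _∧_ (cong (λ ψ → ψ (w₁ (Hs zero)) == x) (φ≗φ′ zero))
                 (cong (λ ψ → ψ (w₂ (Hs (F.fromℕ k))) == y) (φ≗φ′ (F.fromℕ k)))))))
    where
    homs : ∀ i u v → homTest Hs φ G i u v ≡ homTest Hs φ′ G i u v
    homs i u v rewrite φ≗φ′ i = refl
    glues : ∀ i j → glueTest Hs φ i j ≡ glueTest Hs φ′ i j
    glues i j rewrite φ≗φ′ i | φ≗φ′ j = refl
    injs : ∀ i u j v → injTest Hs φ i u j v ≡ injTest Hs φ′ i u j v
    injs i u j v rewrite φ≗φ′ i | φ≗φ′ j = refl

module Gluing where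

  open BooleanTests
  open FunctionCounts
  open Embeddings
  open import Data.Nat using (ℕ; zero; suc; _+_)
  open import Data.Nat.Properties
  open import Data.Fin as F using (Fin; zero; suc; toℕ; splitAt; inject₁)
  import Data.Fin.Properties as FP
  open import Data.Bool using (true)
  open import Data.Product using (_×_; _,_)
  open import Data.Sum using (_⊎_; inj₁; inj₂; [_,_]′)
  open import Relation.Nullary using (yes; no; contradiction)
  open import Relation.Binary.PropositionalEquality

  splitAt-fromℕ : ∀ k l → splitAt (suc k) (F.fromℕ (k + suc l)) ≡ inj₂ (F.fromℕ l)
  splitAt-fromℕ zero    l = refl
  splitAt-fromℕ (suc k) l rewrite splitAt-fromℕ k l = refl

  module _ {k l : ℕ} where

    toℕ-splitAt-inj₁ : ∀ {I i} → splitAt (suc k) {suc l} I ≡ inj₁ i → toℕ I ≡ toℕ i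
    toℕ-splitAt-inj₁ {I} {i} eq = trans (cong toℕ (sym (FP.splitAt⁻¹-↑ˡ eq))) (FP.toℕ-↑ˡ i (suc l))

    toℕ-splitAt-inj₂ : ∀ {I j} → splitAt (suc k) {suc l} I ≡ inj₂ j → toℕ I ≡ suc k + toℕ j
    toℕ-splitAt-inj₂ {I} {j} eq = trans (cong toℕ (sym (FP.splitAt⁻¹-↑ʳ eq))) (FP.toℕ-↑ʳ (suc k) j)

    splitAt-injective : ∀ {I J x} → splitAt (suc k) {suc l} I ≡ x → splitAt (suc k) J ≡ x → I ≡ J
    splitAt-injective {x = inj₁ i} eqI eqJ = trans (sym (FP.splitAt⁻¹-↑ˡ eqI)) (FP.splitAt⁻¹-↑ˡ eqJ)
    splitAt-injective {x = inj₂ j} eqI eqJ = trans (sym (FP.splitAt⁻¹-↑ʳ eqI)) (FP.splitAt⁻¹-↑ʳ eqJ)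

  successor-across : ∀ k (i : Fin (suc k)) (j : ℕ) → suc k + j ≡ suc (toℕ i) → i ≡ F.fromℕ k × j ≡ 0
  successor-across k i j k+j≡i = FP.toℕ-injective (trans i≡k (sym (FP.toℕ-fromℕ k))) , j≡0
    where
    j≡0 : j ≡ 0
    j≡0 = n≤0⇒n≡0 (+-cancelˡ-≤ (suc k) j 0
            (≤-trans (≤-reflexive k+j≡i) (≤-trans (FP.toℕ<n i) (≤-reflexive (sym (+-identityʳ (suc k)))))))
    i≡k : toℕ i ≡ k
    i≡k = suc-injective (trans (sym k+j≡i) (trans (cong (suc k +_) j≡0) (+-identityʳ (suc k))))

  -- Only first vertices of copies of the K-path may be shared with the H-path: they are the common
  -- endpoint or glued to a vertex of the preceding copy.
  Disjoint : ∀ {r n k l} → (Fin (suc l) → TPGraph r) →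
    (Fin (suc k) → Fin (suc r) → Fin n) → (Fin (suc l) → Fin (suc r) → Fin n) → Set
  Disjoint Ks φ₁ φ₂ = ∀ i u j v → v ≢ w₁ (Ks j) → φ₁ i u ≢ φ₂ j v

  module _ {r n k l : ℕ} {G : Graph n} {Hs : Fin (suc k) → TPGraph r} {Ks : Fin (suc l) → TPGraph r}
           {x y z : Fin n} {φ₁ : Fin (suc k) → Fin (suc r) → Fin n} {φ₂ : Fin (suc l) → Fin (suc r) → Fin n}
           (E₁ : IsEmbedding G Hs x z φ₁) (E₂ : IsEmbedding G Ks z y φ₂) (disjoint : Disjoint Ks φ₁ φ₂) where

    private
      module E₁ = IsEmbedding E₁
      module E₂ = IsEmbedding E₂

      HK : Fin (suc (k + suc l)) → TPGraph r
      HK I = [ Hs , Ks ]′ (splitAt (suc k) I)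

      φ : Fin (suc (k + suc l)) → Fin (suc r) → Fin n
      φ I = [ φ₁ , φ₂ ]′ (splitAt (suc k) I)

      hom : ∀ I U V → adj (graph ([ Hs , Ks ]′ (splitAt (suc k) I))) U V ≡ true →
        adj G ([ φ₁ , φ₂ ]′ (splitAt (suc k) I) U) ([ φ₁ , φ₂ ]′ (splitAt (suc k) I) V) ≡ true
      hom I U V with splitAt (suc k) I
      ... | inj₁ i = E₁.hom i U V
      ... | inj₂ j = E₂.hom j U V

      glue : ∀ I J → toℕ J ≡ suc (toℕ I) →
        [ φ₁ , φ₂ ]′ (splitAt (suc k) I) (w₂ ([ Hs , Ks ]′ (splitAt (suc k) I)))
        ≡ [ φ₁ , φ₂ ]′ (splitAt (suc k) J) (w₁ ([ Hs , Ks ]′ (splitAt (suc k) J)))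
      glue I J J≡1+I with splitAt (suc k) I in eqI | splitAt (suc k) J in eqJ
      ... | inj₁ i | inj₁ i′ = E₁.glue i i′
        (trans (sym (toℕ-splitAt-inj₁ eqJ)) (trans J≡1+I (cong suc (toℕ-splitAt-inj₁ eqI))))
      ... | inj₂ j | inj₂ j′ = E₂.glue j j′ (+-cancelˡ-≡ (suc k) _ _
        (trans (sym (toℕ-splitAt-inj₂ eqJ)) (trans J≡1+I (trans (cong suc (toℕ-splitAt-inj₂ eqI)) (sym (+-suc (suc k) (toℕ j)))))))
      ... | inj₂ j | inj₁ i′ = contradiction (FP.toℕ<n i′) (≤⇒≯ (begin
            suc k         ≤⟨ m≤m+n (suc k) (toℕ j) ⟩
            suc k + toℕ j ≤⟨ n≤1+n _ ⟩
            suc (suc k + toℕ j) ≡⟨ trans (cong suc (sym (toℕ-splitAt-inj₂ eqI))) (trans (sym J≡1+I) (toℕ-splitAt-inj₁ eqJ)) ⟩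
            toℕ i′        ∎))
        where open ≤-Reasoning
      ... | inj₁ i | inj₂ j with successor-across k i (toℕ j)
                                   (trans (sym (toℕ-splitAt-inj₂ eqJ)) (trans J≡1+I (cong suc (toℕ-splitAt-inj₁ eqI))))
      ...   | refl , j≡0 rewrite FP.toℕ-injective {j = zero} j≡0 = trans E₁.end (sym E₂.start)

      -- A vertex of the H-path equal to a vertex of the K-path must be the shared endpoint.
      crossing : ∀ {I J} i u j v → splitAt (suc k) {suc l} I ≡ inj₁ i → splitAt (suc k) J ≡ inj₂ j →
        φ₁ i u ≡ φ₂ j v → toℕ J ≡ suc (toℕ I) × u ≡ w₂ (Hs i) × v ≡ w₁ (Ks j)
      crossing i u j v eqI eqJ φ₁≡φ₂ with v F.≟ w₁ (Ks j)
      ... | no v≢w₁ = contradiction φ₁≡φ₂ (disjoint i u j v v≢w₁)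
      crossing i u (suc j) v eqI eqJ φ₁≡φ₂ | yes refl =
        contradiction (trans φ₁≡φ₂ (sym (E₂.glue (inject₁ j) (suc j) (cong suc (sym (FP.toℕ-inject₁ j))))))
          (disjoint i u (inject₁ j) (w₂ (Ks (inject₁ j))) (λ w₂≡w₁ → w₁≢w₂ (Ks (inject₁ j)) (sym w₂≡w₁)))
      crossing {I} {J} i u zero v eqI eqJ φ₁≡φ₂ | yes refl
        with E₁.inj i u (F.fromℕ k) (w₂ (Hs (F.fromℕ k))) (trans φ₁≡φ₂ (trans E₂.start (sym E₁.end)))
      ... | inj₁ (refl , refl) = J≡1+I , refl , refl
        where
        J≡1+I : toℕ J ≡ suc (toℕ I)
        J≡1+I = trans (toℕ-splitAt-inj₂ eqJ) (trans (+-identityʳ (suc k))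
                  (cong suc (trans (sym (FP.toℕ-fromℕ k)) (sym (toℕ-splitAt-inj₁ eqI)))))
      ... | inj₂ (inj₁ (_ , _ , w₂≡w₁)) = contradiction (sym w₂≡w₁) (w₁≢w₂ (Hs (F.fromℕ k)))
      ... | inj₂ (inj₂ (i≡1+k , _ , _)) =
        contradiction (trans i≡1+k (cong suc (FP.toℕ-fromℕ k))) (<⇒≢ (FP.toℕ<n i))

      inj : ∀ I U J V → [ φ₁ , φ₂ ]′ (splitAt (suc k) I) U ≡ [ φ₁ , φ₂ ]′ (splitAt (suc k) J) V →
        (I ≡ J × U ≡ V) ⊎
        (toℕ J ≡ suc (toℕ I) × U ≡ w₂ ([ Hs , Ks ]′ (splitAt (suc k) I)) × V ≡ w₁ ([ Hs , Ks ]′ (splitAt (suc k) J))) ⊎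
        (toℕ I ≡ suc (toℕ J) × V ≡ w₂ ([ Hs , Ks ]′ (splitAt (suc k) J)) × U ≡ w₁ ([ Hs , Ks ]′ (splitAt (suc k) I)))
      inj I U J V φI≡φJ with splitAt (suc k) I in eqI | splitAt (suc k) J in eqJ
      ... | inj₁ i | inj₂ j = inj₂ (inj₁ (crossing i U j V eqI eqJ φI≡φJ))
      ... | inj₂ j | inj₁ i = inj₂ (inj₂ (crossing i V j U eqJ eqI (sym φI≡φJ)))
      ... | inj₁ i | inj₁ i′ with E₁.inj i U i′ V φI≡φJ
      ...   | inj₁ (refl , refl) = inj₁ (splitAt-injective eqI eqJ , refl)
      ...   | inj₂ (inj₁ (t , a , b)) =
        inj₂ (inj₁ (trans (toℕ-splitAt-inj₁ eqJ) (trans t (cong suc (sym (toℕ-splitAt-inj₁ eqI)))) , a , b))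
      ...   | inj₂ (inj₂ (t , a , b)) =
        inj₂ (inj₂ (trans (toℕ-splitAt-inj₁ eqI) (trans t (cong suc (sym (toℕ-splitAt-inj₁ eqJ)))) , a , b))
      inj I U J V φI≡φJ | inj₂ j | inj₂ j′ with E₂.inj j U j′ V φI≡φJ
      ...   | inj₁ (refl , refl) = inj₁ (splitAt-injective eqI eqJ , refl)
      ...   | inj₂ (inj₁ (t , a , b)) = inj₂ (inj₁ (trans (toℕ-splitAt-inj₂ eqJ)
        (trans (cong (suc k +_) t) (trans (+-suc (suc k) (toℕ j)) (cong suc (sym (toℕ-splitAt-inj₂ eqI))))) , a , b))
      ...   | inj₂ (inj₂ (t , a , b)) = inj₂ (inj₂ (trans (toℕ-splitAt-inj₂ eqI)
        (trans (cong (suc k +_) t) (trans (+-suc (suc k) (toℕ j′)) (cong suc (sym (toℕ-splitAt-inj₂ eqJ))))) , a , b))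

      end : [ φ₁ , φ₂ ]′ (splitAt (suc k) (F.fromℕ (k + suc l))) (w₂ ([ Hs , Ks ]′ (splitAt (suc k) (F.fromℕ (k + suc l))))) ≡ y
      end rewrite splitAt-fromℕ k l = E₂.end

    append-IsEmbedding : IsEmbedding G HK x y (append (suc k) φ₁ φ₂)
    append-IsEmbedding = record { hom = hom ; glue = glue ; inj = inj ; start = E₁.start ; end = end }

module Overlaps (r n : ℕ) {{_ : NonZero n}} where

  open Sums
  open BooleanTests
  open FunctionCounts
  open Chains r n
  open Embeddings
  open Gluing
  open import Data.Nat using (zero; suc; _+_; _*_; _^_; _≤_; z≤n)
  open import Data.Nat.Properties
  open import Data.Fin as F using (Fin; zero; suc; splitAt; inject₁)
  import Data.Fin.Properties as FP
  open import Data.List using (List; allFin)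
  open import Data.Bool using (Bool; true; false; _∨_; not)
  open import Data.Bool.Properties using (not-involutive)
  open import Data.Product using (_,_)
  open import Data.Sum using ([_,_]′)
  open import Relation.Nullary using (¬_; yes; no; Dec; contradiction)
  open import Relation.Binary.PropositionalEquality
  open import Function using (_∘_)

  private
    variable
      k : ℕ

  𝟙-chainFrom≡1 : ∀ k Hs a (φ : Fin (suc k) → CopyMap) → φ zero (w₁ (Hs zero)) ≡ a →
    (∀ (i : Fin k) → φ (inject₁ i) (w₂ (Hs (inject₁ i))) ≡ φ (suc i) (w₁ (Hs (suc i)))) →
    𝟙-chainFrom k Hs a φ ≡ 1
  𝟙-chainFrom≡1 zero    Hs a φ start _    = 𝟙-≡ start
  𝟙-chainFrom≡1 (suc k) Hs a φ start glue =
    *-one (𝟙-≡ start) (𝟙-chainFrom≡1 k (Hs ∘ suc) _ (φ ∘ suc) (sym (glue zero)) (glue ∘ suc))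

  module _ {G : Graph n} {Hs : Fin (suc k) → TPGraph r} {x z : Fin n} {φ : Fin (suc k) → CopyMap}
           (E : IsEmbedding G Hs x z φ) where

    IsEmbedding⇒𝟙-chainFrom≡1 : 𝟙-chainFrom k Hs x φ ≡ 1
    IsEmbedding⇒𝟙-chainFrom≡1 = 𝟙-chainFrom≡1 k Hs x φ (IsEmbedding.start E)
      (λ i → IsEmbedding.glue E (inject₁ i) (suc i) (cong suc (sym (FP.toℕ-inject₁ i))))

    IsEmbedding⇒𝟙-endsAt≡1 : 𝟙-endsAt k Hs z φ ≡ 1
    IsEmbedding⇒𝟙-endsAt≡1 = 𝟙-≡ (IsEmbedding.end E)

  numEmb≡∑ : (G : Graph n) (Hs : Fin (suc k) → TPGraph r) (x y : Fin n) →
    numEmb G (hvec k Hs) x y ≡ ∑ (chainMaps k) (λ φ → 𝟙 (isEmbedding G (hvec k Hs) x y φ))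
  numEmb≡∑ {k} G Hs x y = sum-map≡∑ (chainMaps k) _

  module Pair (G : Graph n) {k l : ℕ} (Hs : Fin (suc k) → TPGraph r) (Ks : Fin (suc l) → TPGraph r)
              (x y : Fin n) (x≢y : x ≢ y) where

    Path₁ Path₂ : Set
    Path₁ = Fin (suc k) → CopyMap
    Path₂ = Fin (suc l) → CopyMap

    E₁ : Fin n → Path₁ → ℕ
    E₁ z φ₁ = 𝟙 (isEmbedding G (hvec k Hs) x z φ₁)

    E₂ : Fin n → Path₂ → ℕ
    E₂ z φ₂ = 𝟙 (isEmbedding G (hvec l Ks) z y φ₂)

    HK : Fin (suc (k + suc l)) → TPGraph r
    HK I = [ Hs , Ks ]′ (splitAt (suc k) I)

    E : (Fin (suc (k + suc l)) → CopyMap) → ℕ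
    E φ = 𝟙 (isEmbedding G (hvec (k + suc l) HK) x y φ)

    end₁ : Path₁ → Fin n
    end₁ φ₁ = φ₁ (F.fromℕ k) (w₂ (Hs (F.fromℕ k)))

    N₁ N₂ : Fin n → ℕ
    N₁ z = numEmb G (hvec k Hs) x z
    N₂ z = numEmb G (hvec l Ks) z y

    N : ℕ
    N = numEmb G (concatH (hvec k Hs) (hvec l Ks)) x y

    both-embeddings : ∀ z φ₁ φ₂ t {c} → (IsEmbedding G Hs x z φ₁ → IsEmbedding G Ks z y φ₂ → t ≤ c) →
      E₁ z φ₁ * E₂ z φ₂ * t ≤ c
    both-embeddings z φ₁ φ₂ t t≤c = 𝟙*𝟙*≤ _ _ (λ e₁ e₂ →
      t≤c (isEmbedding⇒IsEmbedding G Hs x z φ₁ e₁) (isEmbedding⇒IsEmbedding G Ks z y φ₂ e₂))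

    disjointTest : Path₁ → Path₂ → Fin (suc k) → Fin (suc r) → Fin (suc l) → Fin (suc r) → Bool
    disjointTest φ₁ φ₂ i u j v = (v == w₁ (Ks j)) ∨ not (φ₁ i u == φ₂ j v)

    disjoint? : Path₁ → Path₂ → Bool
    disjoint? φ₁ φ₂ = ∀F λ i → ∀F λ u → ∀F λ j → ∀F (disjointTest φ₁ φ₂ i u j)

    disjoint?⇒Disjoint : ∀ φ₁ φ₂ → disjoint? φ₁ φ₂ ≡ true → Disjoint Ks φ₁ φ₂
    disjoint?⇒Disjoint φ₁ φ₂ dis i u j v v≢w₁ φ₁≡φ₂ = contradiction (≡⇒==true φ₁≡φ₂)
      (test-false (∀F₄-elim (disjointTest φ₁ φ₂) dis i u j v) (≢⇒==false v≢w₁))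
      where
      test-false : ∀ {p q} → (p ∨ not q) ≡ true → p ≡ false → q ≢ true
      test-false {false} {true} () refl refl

    ∑triples : (Fin n → Path₁ → Path₂ → ℕ) → ℕ
    ∑triples T = ∑Fin n λ z → ∑ (chainMaps k) λ φ₁ → ∑ (chainMaps l) λ φ₂ → T z φ₁ φ₂

    ∑triples-+ : ∀ S T → ∑triples (λ z φ₁ φ₂ → S z φ₁ φ₂ + T z φ₁ φ₂) ≡ ∑triples S + ∑triples T
    ∑triples-+ S T = trans (∑-cong (allFin n) (λ z → trans
        (∑-cong (chainMaps k) (λ φ₁ → ∑-+ (chainMaps l) (S z φ₁) (T z φ₁)))
        (∑-+ (chainMaps k) _ _)))
      (∑-+ (allFin n) _ _)

    ∑triples-mono : ∀ {S T} → (∀ z φ₁ φ₂ → S z φ₁ φ₂ ≤ T z φ₁ φ₂) → ∑triples S ≤ ∑triples T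
    ∑triples-mono S≤T = ∑-mono (allFin n) λ z → ∑-mono (chainMaps k) λ φ₁ → ∑-mono (chainMaps l) (S≤T z φ₁)

    ∑triples-comm : ∀ T → ∑triples T ≡ ∑ (chainMaps k) λ φ₁ → ∑ (chainMaps l) λ φ₂ → ∑Fin n λ z → T z φ₁ φ₂
    ∑triples-comm T = trans (∑-comm (allFin n) (chainMaps k) _)
      (∑-cong (chainMaps k) (λ φ₁ → ∑-comm (allFin n) (chainMaps l) (λ z φ₂ → T z φ₁ φ₂)))

    ∑triples-zero : ∀ T → (∀ z φ₁ φ₂ → T z φ₁ φ₂ ≡ 0) → ∑triples T ≡ 0
    ∑triples-zero T T≡0 = trans (∑-cong (allFin n) λ z → trans (∑-cong (chainMaps k) λ φ₁ →
        trans (∑-cong (chainMaps l) (T≡0 z φ₁)) (∑-zero (chainMaps l))) (∑-zero (chainMaps k)))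
      (∑-zero (allFin n))

    -- The middle vertex z of an overlapping pair is the end of the first path.
    ∑triples-≤-at-end₁ : ∀ T (g : Path₁ → ℕ) (h : Path₁ → Fin n → Path₂ → ℕ) →
      (∀ z φ₁ φ₂ → T z φ₁ φ₂ ≤ g φ₁ * (𝟙 (z == end₁ φ₁) * h φ₁ z φ₂)) →
      ∑triples T ≤ ∑ (chainMaps k) (λ φ₁ → g φ₁ * ∑ (chainMaps l) (h φ₁ (end₁ φ₁)))
    ∑triples-≤-at-end₁ T g h T≤ = begin
        ∑triples T
      ≡⟨ ∑triples-comm T ⟩
        ∑ (chainMaps k) (λ φ₁ → ∑ (chainMaps l) λ φ₂ → ∑Fin n λ z → T z φ₁ φ₂)
      ≤⟨ ∑-mono (chainMaps k) (λ φ₁ → ∑-mono (chainMaps l) λ φ₂ → ≤-trans (∑-mono (allFin n) (λ z → T≤ z φ₁ φ₂))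
           (≤-reflexive (trans (∑-*ˡ (allFin n) (g φ₁) _) (cong (g φ₁ *_) (∑Fin-𝟙== n (end₁ φ₁) (λ z → h φ₁ z φ₂)))))) ⟩
        ∑ (chainMaps k) (λ φ₁ → ∑ (chainMaps l) λ φ₂ → g φ₁ * h φ₁ (end₁ φ₁) φ₂)
      ≡⟨ ∑-cong (chainMaps k) (λ φ₁ → ∑-*ˡ (chainMaps l) (g φ₁) (h φ₁ (end₁ φ₁))) ⟩
        ∑ (chainMaps k) (λ φ₁ → g φ₁ * ∑ (chainMaps l) (h φ₁ (end₁ φ₁)))
      ∎
      where open ≤-Reasoning

    disjoint-pair≤ : ∀ z φ₁ φ₂ →
      E₁ z φ₁ * E₂ z φ₂ * 𝟙 (disjoint? φ₁ φ₂) ≤ 𝟙 (z == end₁ φ₁) * E (append (suc k) φ₁ φ₂)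
    disjoint-pair≤ z φ₁ φ₂ = both-embeddings z φ₁ φ₂ _ (λ e₁ e₂ → 𝟙≤ (disjoint? φ₁ φ₂) (λ dis →
      ≤-reflexive (sym (*-one (𝟙-≡ (sym (IsEmbedding.end e₁)))
        (𝟙-true (IsEmbedding⇒isEmbedding G HK x y _ (append-IsEmbedding e₁ e₂ (disjoint?⇒Disjoint φ₁ φ₂ dis))))))))

    N≡∑∑E : N ≡ ∑ (chainMaps k) λ φ₁ → ∑ (chainMaps l) λ φ₂ → E (append (suc k) φ₁ φ₂)
    N≡∑∑E = trans (numEmb≡∑ G HK x y) (∑-allFuns-+ (suc k) (suc l) copyMaps E (𝟙-isEmbedding-ext G HK x y))

    N₁*N₂≡∑∑ : ∀ z → N₁ z * N₂ z ≡ ∑ (chainMaps k) λ φ₁ → ∑ (chainMaps l) λ φ₂ → E₁ z φ₁ * E₂ z φ₂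
    N₁*N₂≡∑∑ z = begin
        N₁ z * N₂ z
      ≡⟨ cong₂ _*_ (numEmb≡∑ G Hs x z) (numEmb≡∑ G Ks z y) ⟩
        ∑ (chainMaps k) (E₁ z) * ∑ (chainMaps l) (E₂ z)
      ≡⟨ ∑-*ʳ (chainMaps k) (∑ (chainMaps l) (E₂ z)) (E₁ z) ⟨
        ∑ (chainMaps k) (λ φ₁ → E₁ z φ₁ * ∑ (chainMaps l) (E₂ z))
      ≡⟨ ∑-cong (chainMaps k) (λ φ₁ → ∑-*ˡ (chainMaps l) (E₁ z φ₁) (E₂ z)) ⟨
        ∑ (chainMaps k) (λ φ₁ → ∑ (chainMaps l) λ φ₂ → E₁ z φ₁ * E₂ z φ₂)
      ∎
      where open ≡-Reasoning

    Overlapping : ℕ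
    Overlapping = ∑triples (λ z φ₁ φ₂ → E₁ z φ₁ * E₂ z φ₂ * 𝟙 (not (disjoint? φ₁ φ₂)))

    ∑N₁*N₂≤N+Overlapping : ∑Fin n (λ z → N₁ z * N₂ z) ≤ N + Overlapping
    ∑N₁*N₂≤N+Overlapping = begin
        ∑Fin n (λ z → N₁ z * N₂ z)
      ≡⟨ ∑-cong (allFin n) N₁*N₂≡∑∑ ⟩
        ∑triples (λ z φ₁ φ₂ → E₁ z φ₁ * E₂ z φ₂)
      ≡⟨ ∑-cong (allFin n) (λ z → ∑-cong (chainMaps k) λ φ₁ → ∑-cong (chainMaps l) λ φ₂ →
           *𝟙-split (E₁ z φ₁ * E₂ z φ₂) (disjoint? φ₁ φ₂)) ⟩
        ∑triples (λ z φ₁ φ₂ → DisjointPair z φ₁ φ₂ + E₁ z φ₁ * E₂ z φ₂ * 𝟙 (not (disjoint? φ₁ φ₂)))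
      ≡⟨ ∑triples-+ DisjointPair _ ⟩
        ∑triples DisjointPair + Overlapping
      ≡⟨ cong (_+ Overlapping) (∑triples-comm DisjointPair) ⟩
        ∑ (chainMaps k) (λ φ₁ → ∑ (chainMaps l) λ φ₂ → ∑Fin n λ z → DisjointPair z φ₁ φ₂) + Overlapping
      ≤⟨ +-monoˡ-≤ Overlapping (∑-mono (chainMaps k) λ φ₁ → ∑-mono (chainMaps l) λ φ₂ →
           ≤-trans (∑-mono (allFin n) (λ z → disjoint-pair≤ z φ₁ φ₂))
                   (≤-reflexive (∑Fin-𝟙== n (end₁ φ₁) (λ _ → E (append (suc k) φ₁ φ₂))))) ⟩
        ∑ (chainMaps k) (λ φ₁ → ∑ (chainMaps l) λ φ₂ → E (append (suc k) φ₁ φ₂)) + Overlapping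
      ≡⟨ cong (_+ Overlapping) N≡∑∑E ⟨
        N + Overlapping
      ∎
      where
      open ≤-Reasoning
      DisjointPair : Fin n → Path₁ → Path₂ → ℕ
      DisjointPair z φ₁ φ₂ = E₁ z φ₁ * E₂ z φ₂ * 𝟙 (disjoint? φ₁ φ₂)

    ∑⁴ : (Fin (suc k) → Fin (suc r) → Fin (suc l) → Fin (suc r) → ℕ) → ℕ
    ∑⁴ f = ∑Fin (suc k) λ i → ∑Fin (suc r) λ u → ∑Fin (suc l) λ j → ∑Fin (suc r) λ v → f i u j v

    ∑⁴-*ˡ : ∀ c f → c * ∑⁴ f ≡ ∑⁴ (λ i u j v → c * f i u j v)
    ∑⁴-*ˡ c f = sym (trans (∑-cong (allFin (suc k)) λ i → trans (∑-cong (allFin (suc r)) λ u →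
        trans (∑-cong (allFin (suc l)) λ j → ∑-*ˡ (allFin (suc r)) c (f i u j))
              (∑-*ˡ (allFin (suc l)) c (λ j → ∑Fin (suc r) (f i u j))))
        (∑-*ˡ (allFin (suc r)) c (λ u → ∑Fin (suc l) λ j → ∑Fin (suc r) (f i u j))))
      (∑-*ˡ (allFin (suc k)) c (λ i → ∑Fin (suc r) λ u → ∑Fin (suc l) λ j → ∑Fin (suc r) (f i u j))))

    ∑⁴-comm : {A : Set} (xs : List A) (f : A → Fin (suc k) → Fin (suc r) → Fin (suc l) → Fin (suc r) → ℕ) →
      ∑ xs (λ a → ∑⁴ (f a)) ≡ ∑⁴ (λ i u j v → ∑ xs (λ a → f a i u j v))
    ∑⁴-comm xs f =
      trans (∑-comm xs (allFin (suc k)) (λ a i → ∑Fin (suc r) λ u → ∑Fin (suc l) λ j → ∑Fin (suc r) (f a i u j)))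
      (∑-cong (allFin (suc k)) λ i →
      trans (∑-comm xs (allFin (suc r)) (λ a u → ∑Fin (suc l) λ j → ∑Fin (suc r) (f a i u j)))
      (∑-cong (allFin (suc r)) λ u →
      trans (∑-comm xs (allFin (suc l)) (λ a j → ∑Fin (suc r) (f a i u j)))
      (∑-cong (allFin (suc l)) λ j → ∑-comm xs (allFin (suc r)) (λ a → f a i u j))))

    ∑⁴≤ : ∀ f c → (∀ i u j v → f i u j v ≤ c) → ∑⁴ f ≤ suc k * (suc r * (suc l * (suc r * c)))
    ∑⁴≤ f c f≤c =
      ≤-trans (∑≤length* (allFin (suc k)) _ _ (λ i →
      ≤-trans (∑≤length* (allFin (suc r)) _ _ (λ u →
      ≤-trans (∑≤length* (allFin (suc l)) _ _ (λ j →
      ≤-trans (∑≤length* (allFin (suc r)) _ c (f≤c i u j))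
              (≤-reflexive (cong (_* c) (length-allFin (suc r))))))
              (≤-reflexive (cong (_* (suc r * c)) (length-allFin (suc l))))))
              (≤-reflexive (cong (_* (suc l * (suc r * c))) (length-allFin (suc r))))))
              (≤-reflexive (cong (_* (suc r * (suc l * (suc r * c)))) (length-allFin (suc k))))

    overlaps : Fin (suc k) → Fin (suc r) → Fin (suc l) → Fin (suc r) → ℕ
    overlaps i u j v = ∑triples (λ z φ₁ φ₂ → E₁ z φ₁ * E₂ z φ₂ * 𝟙 (not (disjointTest φ₁ φ₂ i u j v)))

    Overlapping≤∑⁴overlaps : Overlapping ≤ ∑⁴ overlaps
    Overlapping≤∑⁴overlaps = begin
        Overlapping
      ≤⟨ ∑triples-mono (λ z φ₁ φ₂ → *-monoʳ-≤ (E₁ z φ₁ * E₂ z φ₂) (𝟙-not-∀F₄ (disjointTest φ₁ φ₂))) ⟩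
        ∑triples (λ z φ₁ φ₂ → E₁ z φ₁ * E₂ z φ₂ * ∑⁴ (T z φ₁ φ₂))
      ≡⟨ ∑-cong (allFin n) (λ z → ∑-cong (chainMaps k) λ φ₁ → ∑-cong (chainMaps l) λ φ₂ →
           ∑⁴-*ˡ (E₁ z φ₁ * E₂ z φ₂) (T z φ₁ φ₂)) ⟩
        ∑triples (λ z φ₁ φ₂ → ∑⁴ (λ i u j v → E₁ z φ₁ * E₂ z φ₂ * T z φ₁ φ₂ i u j v))
      ≡⟨ trans (∑-cong (allFin n) (λ z → trans (∑-cong (chainMaps k) λ φ₁ → ∑⁴-comm (chainMaps l) _)
                                                (∑⁴-comm (chainMaps k) _)))
               (∑⁴-comm (allFin n) _) ⟩
        ∑⁴ overlaps
      ∎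
      where
      open ≤-Reasoning
      T : Fin n → Path₁ → Path₂ → Fin (suc k) → Fin (suc r) → Fin (suc l) → Fin (suc r) → ℕ
      T z φ₁ φ₂ i u j v = 𝟙 (not (disjointTest φ₁ φ₂ i u j v))

    W : ℕ
    W = n ^ (suc k * r) * n ^ (suc l * r)

    𝟙-not-disjointTest : ∀ φ₁ φ₂ i u j v → v ≢ w₁ (Ks j) →
      𝟙 (not (disjointTest φ₁ φ₂ i u j v)) ≡ 𝟙 (φ₁ i u == φ₂ j v)
    𝟙-not-disjointTest φ₁ φ₂ i u j v v≢w₁ rewrite ≢⇒==false v≢w₁ = cong 𝟙 (not-involutive _)

    overlaps-at-w₁ : ∀ i u j → overlaps i u j (w₁ (Ks j)) ≡ 0
    overlaps-at-w₁ i u j = ∑triples-zero _ (λ z φ₁ φ₂ →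
      trans (cong (λ b → E₁ z φ₁ * E₂ z φ₂ * 𝟙 (not (b ∨ _))) (==-refl (w₁ (Ks j)))) (*-zeroʳ (E₁ z φ₁ * E₂ z φ₂)))

    overlaps-x-y : w₂ (Ks (F.fromℕ l)) ≢ w₁ (Ks (F.fromℕ l)) →
      overlaps zero (w₁ (Hs zero)) (F.fromℕ l) (w₂ (Ks (F.fromℕ l))) ≡ 0
    overlaps-x-y w₂≢w₁ = ∑triples-zero _ (λ z φ₁ φ₂ → n≤0⇒n≡0 (both-embeddings z φ₁ φ₂ _ (λ e₁ e₂ →
      ≤-reflexive (trans (𝟙-not-disjointTest φ₁ φ₂ _ _ _ _ w₂≢w₁)
        (cong 𝟙 (trans (cong₂ _==_ (IsEmbedding.start e₁) (IsEmbedding.end e₂)) (≢⇒==false x≢y)))))))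

    *-^-merge : ∀ S a b → S * n ^ a * n ^ b ≡ S * n ^ (a + b)
    *-^-merge S a b = trans (*-assoc S _ _) (cong (S *_) (sym (^-distribˡ-+-* n a b)))

    overlaps-inner : ∀ i u j v → v ≢ w₁ (Ks j) → ¬ IsEnd Ks j v → overlaps i u j v * n ^ 2 ≤ W
    overlaps-inner i u j v v≢w₁ ¬end = begin
        overlaps i u j v * n ^ 2
      ≡⟨ *-^-merge (overlaps i u j v) 2 0 ⟨
        overlaps i u j v * n ^ 2 * n ^ 0
      ≤⟨ *-monoˡ-≤ (n ^ 0) (*-monoˡ-≤ (n ^ 2) (∑triples-≤-at-end₁ _ g h T≤)) ⟩
        ∑ (chainMaps k) (λ φ₁ → g φ₁ * ∑ (chainMaps l) (h φ₁ (end₁ φ₁))) * n ^ 2 * n ^ 0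
      ≤⟨ ∑-*-≤ (chainMaps k) g _ (λ φ₁ → ∑-chainFrom-to-through l Ks (end₁ φ₁) y j v (φ₁ i u) v≢w₁ ¬end)
                                 (∑-chainFrom k Hs x) ⟩
        W
      ∎
      where
      open ≤-Reasoning
      g : Path₁ → ℕ
      g φ₁ = 𝟙-chainFrom k Hs x φ₁
      h : Path₁ → Fin n → Path₂ → ℕ
      h φ₁ z φ₂ = 𝟙-chainFrom l Ks z φ₂ * 𝟙-endsAt l Ks y φ₂ * 𝟙 (φ₂ j v == φ₁ i u)
      T≤ : ∀ z φ₁ φ₂ → E₁ z φ₁ * E₂ z φ₂ * 𝟙 (not (disjointTest φ₁ φ₂ i u j v)) ≤ g φ₁ * (𝟙 (z == end₁ φ₁) * h φ₁ z φ₂)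
      T≤ z φ₁ φ₂ = both-embeddings z φ₁ φ₂ _ (λ e₁ e₂ →
        ≤-trans (≤-reflexive (𝟙-not-disjointTest φ₁ φ₂ i u j v v≢w₁)) (𝟙≤ (φ₁ i u == φ₂ j v) (λ meet →
          ≤-reflexive (sym (*-one (IsEmbedding⇒𝟙-chainFrom≡1 e₁) (*-one (𝟙-≡ (sym (IsEmbedding.end e₁)))
            (*-one (*-one (IsEmbedding⇒𝟙-chainFrom≡1 e₂) (IsEmbedding⇒𝟙-endsAt≡1 e₂)) (𝟙-≡ (sym (==⇒≡ meet))))))))))

    overlaps-at-y : ∀ i u → ¬ IsStart Hs i u → w₂ (Ks (F.fromℕ l)) ≢ w₁ (Ks (F.fromℕ l)) →
      overlaps i u (F.fromℕ l) (w₂ (Ks (F.fromℕ l))) * n ^ 2 ≤ W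
    overlaps-at-y i u ¬start w₂≢w₁ = begin
        overlaps i u j v * n ^ 2
      ≡⟨ *-^-merge (overlaps i u j v) 1 1 ⟨
        overlaps i u j v * n ^ 1 * n ^ 1
      ≤⟨ *-monoˡ-≤ (n ^ 1) (*-monoˡ-≤ (n ^ 1) (∑triples-≤-at-end₁ _ g h T≤)) ⟩
        ∑ (chainMaps k) (λ φ₁ → g φ₁ * ∑ (chainMaps l) (h φ₁ (end₁ φ₁))) * n ^ 1 * n ^ 1
      ≤⟨ ∑-*-≤ (chainMaps k) g _ (λ φ₁ → ∑-chainFrom-to l Ks (end₁ φ₁) y) (∑-chainFrom-through k Hs x i u y ¬start) ⟩
        W
      ∎
      where
      open ≤-Reasoning
      j = F.fromℕ l
      v = w₂ (Ks (F.fromℕ l))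
      g : Path₁ → ℕ
      g φ₁ = 𝟙-chainFrom k Hs x φ₁ * 𝟙 (φ₁ i u == y)
      h : Path₁ → Fin n → Path₂ → ℕ
      h φ₁ z φ₂ = 𝟙-chainFrom l Ks z φ₂ * 𝟙-endsAt l Ks y φ₂
      T≤ : ∀ z φ₁ φ₂ → E₁ z φ₁ * E₂ z φ₂ * 𝟙 (not (disjointTest φ₁ φ₂ i u j v)) ≤ g φ₁ * (𝟙 (z == end₁ φ₁) * h φ₁ z φ₂)
      T≤ z φ₁ φ₂ = both-embeddings z φ₁ φ₂ _ (λ e₁ e₂ →
        ≤-trans (≤-reflexive (𝟙-not-disjointTest φ₁ φ₂ i u j v w₂≢w₁)) (𝟙≤ (φ₁ i u == φ₂ j v) (λ meet →
          ≤-reflexive (sym (*-one (*-one (IsEmbedding⇒𝟙-chainFrom≡1 e₁) (𝟙-≡ (trans (==⇒≡ meet) (IsEmbedding.end e₂))))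
            (*-one (𝟙-≡ (sym (IsEmbedding.end e₁)))
              (*-one (IsEmbedding⇒𝟙-chainFrom≡1 e₂) (IsEmbedding⇒𝟙-endsAt≡1 e₂))))))))

    overlaps-at-end : ∀ i u → w₂ (Ks (F.fromℕ l)) ≢ w₁ (Ks (F.fromℕ l)) →
      overlaps i u (F.fromℕ l) (w₂ (Ks (F.fromℕ l))) * n ^ 2 ≤ W
    overlaps-at-end i u w₂≢w₁ with i F.≟ zero | u F.≟ w₁ (Hs zero)
    ... | yes refl | yes refl = ≤-trans (≤-reflexive (cong (_* n ^ 2) (overlaps-x-y w₂≢w₁))) z≤n
    ... | yes refl | no u≢w₁  = overlaps-at-y zero u (λ (_ , u≡w₁) → u≢w₁ u≡w₁) w₂≢w₁
    ... | no i≢0   | _        = overlaps-at-y i u (λ (i≡0 , _) → i≢0 i≡0) w₂≢w₁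

    overlaps-off-w₁ : ∀ i u j v → v ≢ w₁ (Ks j) → overlaps i u j v * n ^ 2 ≤ W
    overlaps-off-w₁ i u j v v≢w₁ with j F.≟ F.fromℕ l | v F.≟ w₂ (Ks (F.fromℕ l))
    ... | yes refl | yes refl = overlaps-at-end i u v≢w₁
    ... | yes refl | no v≢w₂  = overlaps-inner i u j v v≢w₁ (λ (_ , v≡w₂) → v≢w₂ v≡w₂)
    ... | no j≢l   | _        = overlaps-inner i u j v v≢w₁ (λ (j≡l , _) → j≢l j≡l)

    overlaps*n²≤W : ∀ i u j v → overlaps i u j v * n ^ 2 ≤ W
    overlaps*n²≤W i u j v = by-cases (v F.≟ w₁ (Ks j))
      where
      by-cases : Dec (v ≡ w₁ (Ks j)) → overlaps i u j v * n ^ 2 ≤ W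
      by-cases (yes refl) = ≤-trans (≤-reflexive (cong (_* n ^ 2) (overlaps-at-w₁ i u j))) z≤n
      by-cases (no v≢w₁)  = overlaps-off-w₁ i u j v v≢w₁

    Overlapping*n²≤ : Overlapping * n ^ 2 ≤ suc k * (suc r * (suc l * (suc r * W)))
    Overlapping*n²≤ = begin
        Overlapping * n ^ 2
      ≤⟨ *-monoˡ-≤ (n ^ 2) Overlapping≤∑⁴overlaps ⟩
        ∑⁴ overlaps * n ^ 2
      ≡⟨ trans (*-comm (∑⁴ overlaps) (n ^ 2)) (∑⁴-*ˡ (n ^ 2) overlaps) ⟩
        ∑⁴ (λ i u j v → n ^ 2 * overlaps i u j v)
      ≤⟨ ∑⁴≤ _ W (λ i u j v → ≤-trans (≤-reflexive (*-comm (n ^ 2) _)) (overlaps*n²≤W i u j v)) ⟩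
        suc k * (suc r * (suc l * (suc r * W)))
      ∎
      where open ≤-Reasoning

module RationalBounds where

  open import Data.Nat using (suc; _*_; _≤_)
  open import Data.Nat.Properties using (*-identityʳ)
  open import Data.Integer as ℤ using (+_)
  import Data.Integer.Properties as ℤ
  open import Data.Rational as ℚ using (ℚ; mkℚ; Positive; ↥_; ↧ₙ_)
  import Data.Rational.Properties as ℚ
  open import Data.Rational.Unnormalised as ℚᵘ using (mkℚᵘ; *≤*)
  import Data.Rational.Unnormalised.Properties as ℚᵘ
  import Data.Nat.Coprimality as Coprime
  open import Data.Product using (∃; _,_)
  open import Relation.Binary.PropositionalEquality

  toℚᵘ-fromℕ : ∀ m → ℚ.toℚᵘ (fromℕ m) ≡ mkℚᵘ (+ m) 0
  toℚᵘ-fromℕ m = cong ℚ.toℚᵘ (ℚ.normalize-coprime (Coprime.sym (Coprime.1-coprimeTo m)))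

  toℚᵘ-inv : ∀ d → ℚ.toℚᵘ (inv (suc d)) ≡ mkℚᵘ (+ 1) d
  toℚᵘ-inv d = cong ℚ.toℚᵘ (ℚ.normalize-coprime (Coprime.1-coprimeTo (suc d)))

  +*+ : ∀ a b → + a ℤ.* + b ≡ + (a * b)
  +*+ a b = sym (ℤ.pos-* a b)

  positive-numerator : ∀ p → Positive p → ∃ λ P → ↥ p ≡ + suc P
  positive-numerator (mkℚ (+ suc P) _ _) _ = P , refl

  mkℚᵘ≤fromℕ⇒ : ∀ {i P d N} → i ≡ + P → mkℚᵘ i d ℚᵘ.≤ mkℚᵘ (+ N) 0 → P ≤ N * suc d
  mkℚᵘ≤fromℕ⇒ {P = P} {d} {N} refl (*≤* P*1≤N*d) =
    subst (_≤ N * suc d) (*-identityʳ P) (ℤ.drop‿+≤+ (subst₂ ℤ._≤_ (+*+ P 1) (+*+ N (suc d)) P*1≤N*d))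

  ⇒mkℚᵘ≤fromℕ : ∀ {i P d N} → i ≡ + P → P ≤ N * suc d → mkℚᵘ i d ℚᵘ.≤ mkℚᵘ (+ N) 0
  ⇒mkℚᵘ≤fromℕ {P = P} {d} {N} refl P≤N*d =
    *≤* (subst₂ ℤ._≤_ (sym (+*+ P 1)) (sym (+*+ N (suc d))) (ℤ.+≤+ (subst (_≤ N * suc d) (sym (*-identityʳ P)) P≤N*d)))

  *fromℕ≤fromℕ⇒ : ∀ p {P} a N → ↥ p ≡ + P → p ℚ.* fromℕ a ℚ.≤ fromℕ N → P * a ≤ N * ↧ₙ p
  *fromℕ≤fromℕ⇒ p@(mkℚ num d _) {P} a N ↥p≡P pa≤N =
    subst (λ e → P * a ≤ N * e) (*-identityʳ (suc d))
      (mkℚᵘ≤fromℕ⇒ (trans (cong (ℤ._* + a) ↥p≡P) (+*+ P a)) (subst₂ ℚᵘ._≤_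
        (cong (mkℚᵘ num d ℚᵘ.*_) (toℚᵘ-fromℕ a)) (toℚᵘ-fromℕ N)
        (ℚᵘ.≤-respˡ-≃ (ℚ.toℚᵘ-homo-* p (fromℕ a)) (ℚ.toℚᵘ-mono-≤ pa≤N))))

  ⇒*inv*fromℕ≤fromℕ : ∀ (ε βx βy : ℚ) {pe px py} D c N → ↥ ε ≡ + pe → ↥ βx ≡ + px → ↥ βy ≡ + py →
    pe * px * py * 1 * c ≤ N * (↧ₙ ε * ↧ₙ βx * ↧ₙ βy * suc D * 1) →
    ε ℚ.* βx ℚ.* βy ℚ.* inv (suc D) ℚ.* fromℕ c ℚ.≤ fromℕ N
  ⇒*inv*fromℕ≤fromℕ ε@(mkℚ _ de _) βx@(mkℚ _ dx _) βy@(mkℚ _ dy _) {pe} {px} {py} D c N refl refl refl P≤N*Q =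
    ℚ.toℚᵘ-cancel-≤ (ℚᵘ.≤-respˡ-≃ (ℚᵘ.≃-sym toℚᵘ-product)
      (subst (_ ℚᵘ.≤_) (sym (toℚᵘ-fromℕ N)) (⇒mkℚᵘ≤fromℕ numerator P≤N*Q)))
    where
    toℚᵘ-product : ℚ.toℚᵘ (ε ℚ.* βx ℚ.* βy ℚ.* inv (suc D) ℚ.* fromℕ c) ℚᵘ.≃
                   (mkℚᵘ (+ pe) de ℚᵘ.* mkℚᵘ (+ px) dx ℚᵘ.* mkℚᵘ (+ py) dy ℚᵘ.* mkℚᵘ (+ 1) D ℚᵘ.* mkℚᵘ (+ c) 0)
    toℚᵘ-product =
      ℚᵘ.≃-trans (ℚ.toℚᵘ-homo-* (ε ℚ.* βx ℚ.* βy ℚ.* inv (suc D)) (fromℕ c)) (ℚᵘ.*-cong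
      (ℚᵘ.≃-trans (ℚ.toℚᵘ-homo-* (ε ℚ.* βx ℚ.* βy) (inv (suc D))) (ℚᵘ.*-cong
      (ℚᵘ.≃-trans (ℚ.toℚᵘ-homo-* (ε ℚ.* βx) βy) (ℚᵘ.*-congʳ (ℚ.toℚᵘ-homo-* ε βx)))
      (ℚᵘ.≃-reflexive (toℚᵘ-inv D))))
      (ℚᵘ.≃-reflexive (toℚᵘ-fromℕ c)))
    numerator : + pe ℤ.* + px ℤ.* + py ℤ.* + 1 ℤ.* + c ≡ + (pe * px * py * 1 * c)
    numerator = begin
      + pe ℤ.* + px ℤ.* + py ℤ.* + 1 ℤ.* + c  ≡⟨ cong (λ i → i ℤ.* + py ℤ.* + 1 ℤ.* + c) (+*+ pe px) ⟩
      + (pe * px) ℤ.* + py ℤ.* + 1 ℤ.* + c    ≡⟨ cong (λ i → i ℤ.* + 1 ℤ.* + c) (+*+ (pe * px) py) ⟩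
      + (pe * px * py) ℤ.* + 1 ℤ.* + c        ≡⟨ cong (ℤ._* + c) (+*+ (pe * px * py) 1) ⟩
      + (pe * px * py * 1) ℤ.* + c            ≡⟨ +*+ (pe * px * py * 1) c ⟩
      + (pe * px * py * 1 * c)                ∎
      where open ≡-Reasoning

module Reachability where

  open Sums
  open BooleanTests
  open RationalBounds
  open import Data.Nat using (ℕ; NonZero; zero; suc; _+_; _*_; _^_; _∸_; _≤_; _≥_; z≤n; s≤s)
  open import Data.Nat.Properties
  open import Data.Nat.Tactic.RingSolver using (solve-∀)
  open import Data.Fin using (Fin; zero; suc)
  open import Data.Fin.Subset using (Subset; _∈_; ∣_∣)
  open import Data.Fin.Subset.Properties using (_∈?_)
  open import Data.Vec using ([]; _∷_)
  open import Data.List as List using (List; allFin)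
  open import Data.List.NonEmpty as List⁺ using (List⁺; _∷_; toList)
  import Data.List.Membership.Propositional as List
  open import Data.List.Membership.Propositional.Properties using (∈-++⁺ʳ; ∈-concatMap⁺; ∈-map⁺)
  open import Data.List.Relation.Unary.Any as Any using ()
  open import Data.Bool using (Bool; true; false; _∧_)
  open import Data.Product using (∃₂; _×_; _,_; proj₁; proj₂)
  open import Data.Rational as ℚ using (ℚ; ↥_; ↧ₙ_)
  import Data.Integer as ℤ
  import Data.Rational.Properties as ℚ
  open import Relation.Nullary using (¬_; Dec; does; yes)
  open import Relation.Nullary.Decidable using (dec-true)
  open import Relation.Binary.PropositionalEquality

  ∣_∣≡∑𝟙∈ : ∀ {n} (U : Subset n) → ∣ U ∣ ≡ ∑Fin n (λ z → 𝟙 (does (z ∈? U)))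
  ∣ []        ∣≡∑𝟙∈ = refl
  ∣ true  ∷ U ∣≡∑𝟙∈ = trans (cong suc (∣ U ∣≡∑𝟙∈)) (sym (∑Fin-suc _ (λ z → 𝟙 (does (z ∈? (true ∷ U))))))
  ∣ false ∷ U ∣≡∑𝟙∈ = trans ∣ U ∣≡∑𝟙∈ (sym (∑Fin-suc _ (λ z → 𝟙 (does (z ∈? (false ∷ U))))))

  does∧does-sound : {P Q : Set} (p : Dec P) (q : Dec Q) → (does p ∧ does q) ≡ true → P × Q
  does∧does-sound (yes p) (yes q) _ = p , q

  module Selection {r n : ℕ} (G : Graph n) (βx βy : ℚ) (x y : Fin n) where

    -- Opaque, so that conversion checking never runs this decision procedure on numEmb.
    opaque
      reachable? : ∀ H β a b → Dec (Reachable {r} G H β a b)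
      reachable? H β a b = _ ℚ.≤? _

    through? : HVec r → HVec r → Fin n → Bool
    through? H K z = does (reachable? H βx x z) ∧ does (reachable? K βy z y)

    through?-sound : ∀ H K z → through? H K z ≡ true → Reachable G H βx x z × Reachable G K βy z y
    through?-sound H K z = does∧does-sound (reachable? H βx x z) (reachable? K βy z y)

    hits : HVec r → HVec r → ℕ
    hits H K = ∑Fin n (λ z → 𝟙 (through? H K z))

    module _ (𝓗x 𝓗y : List⁺ (HVec r)) (U : Subset n)
             (reach : (z : Fin n) → z ∈ U → ReachableSet G 𝓗x βx x z × ReachableSet G 𝓗y βy z y) where

      ∣U∣≤∑∑hits : ∣ U ∣ ≤ ∑ (toList 𝓗x) λ H → ∑ (toList 𝓗y) λ K → hits H K
      ∣U∣≤∑∑hits = begin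
          ∣ U ∣
        ≡⟨ ∣ U ∣≡∑𝟙∈ ⟩
          ∑Fin n (λ z → 𝟙 (does (z ∈? U)))
        ≤⟨ ∑-mono (allFin n) (λ z → 𝟙≤ (does (z ∈? U)) (covered z (z ∈? U))) ⟩
          ∑Fin n (λ z → ∑ (toList 𝓗x) λ H → ∑ (toList 𝓗y) λ K → 𝟙 (through? H K z))
        ≡⟨ ∑-comm (allFin n) (toList 𝓗x) _ ⟩
          ∑ (toList 𝓗x) (λ H → ∑Fin n λ z → ∑ (toList 𝓗y) λ K → 𝟙 (through? H K z))
        ≡⟨ ∑-cong (toList 𝓗x) (λ H → ∑-comm (allFin n) (toList 𝓗y) _) ⟩
          ∑ (toList 𝓗x) (λ H → ∑ (toList 𝓗y) λ K → hits H K)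
        ∎
        where
        open ≤-Reasoning
        covered-by : ∀ {z H K} → H List.∈ toList 𝓗x → K List.∈ toList 𝓗y →
          Reachable G H βx x z → Reachable G K βy z y →
          1 ≤ ∑ (toList 𝓗x) λ H → ∑ (toList 𝓗y) λ K → 𝟙 (through? H K z)
        covered-by {z} {H} {K} H∈ K∈ x⇝z z⇝y = begin
          1                                        ≡⟨ cong₂ (λ p q → 𝟙 (p ∧ q)) (dec-true (reachable? H βx x z) x⇝z)
                                                                               (dec-true (reachable? K βy z y) z⇝y) ⟨
          𝟙 (through? H K z)                       ≤⟨ ∈⇒≤∑ (λ K → 𝟙 (through? H K z)) K∈ ⟩
          ∑ (toList 𝓗y) (λ K → 𝟙 (through? H K z)) ≤⟨ ∈⇒≤∑ (λ H → ∑ (toList 𝓗y) λ K → 𝟙 (through? H K z)) H∈ ⟩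
          ∑ (toList 𝓗x) (λ H → ∑ (toList 𝓗y) λ K → 𝟙 (through? H K z)) ∎
        covered : ∀ z (z∈?U : Dec (z ∈ U)) → does z∈?U ≡ true →
          1 ≤ ∑ (toList 𝓗x) λ H → ∑ (toList 𝓗y) λ K → 𝟙 (through? H K z)
        covered z (yes z∈U) _ = let ((_ , H∈ , x⇝z) , (_ , K∈ , z⇝y)) = reach z z∈U in covered-by H∈ K∈ x⇝z z⇝y

      popular-pair : ∃₂ λ H K → H List.∈ toList 𝓗x × K List.∈ toList 𝓗y ×
                                ∣ U ∣ ≤ List⁺.length 𝓗x * (List⁺.length 𝓗y * hits H K)
      popular-pair =
        let H , H∈ , ∑≤  = pigeonhole (List⁺.head 𝓗x) (List⁺.tail 𝓗x) (λ H → ∑ (toList 𝓗y) (hits H))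
            K , K∈ , ∑≤′ = pigeonhole (List⁺.head 𝓗y) (List⁺.tail 𝓗y) (hits H)
        in H , K , H∈ , K∈ , ≤-trans ∣U∣≤∑∑hits (≤-trans ∑≤ (*-monoʳ-≤ (List⁺.length 𝓗x) ∑≤′))

  overlapPositions : ∀ {r} → HVec r → HVec r → ℕ
  overlapPositions {r} H K = tOf H * (suc r * (tOf K * (suc r * 1)))

  -- The factor n² saved on each overlap turns the exponents tr into tr - 1, as r ≥ 1.
  ∑N₁*N₂≤N+overlaps : ∀ {r′ n} {{_ : NonZero n}} (G : Graph n) (H K : HVec (suc r′)) (x y : Fin n) → x ≢ y →
    ∑Fin n (λ z → numEmb G H x z * numEmb G K z y)
    ≤ numEmb G (concatH H K) x y
      + overlapPositions H K * (n ^ (tOf H * suc r′ ∸ 1) * n ^ (tOf K * suc r′ ∸ 1))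
  ∑N₁*N₂≤N+overlaps {r′} {n} G (hvec k Hs) (hvec l Ks) x y x≢y =
    ≤-trans ∑N₁*N₂≤N+Overlapping (+-monoʳ-≤ N Overlapping≤)
    where
    open Overlaps.Pair (suc r′) n G Hs Ks x y x≢y
    a = n ^ (suc k * suc r′ ∸ 1)
    b = n ^ (suc l * suc r′ ∸ 1)
    rearrange : ∀ k l r n a b → k * (r * (l * (r * ((n * a) * (n * b))))) ≡ k * (r * (l * (r * 1))) * (a * b) * (n * (n * 1))
    rearrange = solve-∀
    Overlapping≤ : Overlapping ≤ overlapPositions (hvec k Hs) (hvec l Ks) * (a * b)
    Overlapping≤ = *-cancelʳ-≤ Overlapping _ (n ^ 2) {{m^n≢0 n 2}}
      (≤-trans Overlapping*n²≤ (≤-reflexive (rearrange (suc k) (suc l) (suc (suc r′)) n a b)))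

  absorb : ∀ X K N B → X ≤ K * (N + B) → 2 * (K * B) ≤ X → X ≤ 2 * K * N
  absorb X K N B X≤K[N+B] 2KB≤X = +-cancelʳ-≤ X X (2 * K * N) (begin
      X + X                        ≡⟨ cong (X +_) (+-identityʳ X) ⟨
      2 * X                        ≤⟨ *-monoʳ-≤ 2 X≤K[N+B] ⟩
      2 * (K * (N + B))            ≡⟨ distrib K N B ⟩
      2 * K * N + 2 * (K * B)      ≤⟨ +-monoʳ-≤ (2 * K * N) 2KB≤X ⟩
      2 * K * N + X                ∎)
    where
    open ≤-Reasoning
    distrib : ∀ K N B → 2 * (K * (N + B)) ≡ 2 * K * N + 2 * (K * B)
    distrib = solve-∀

  lower-bound-chain : ∀ pe px py n a b U S Σ qe qx qy tx ty →
    pe * n ≤ U * qe → U ≤ tx * (ty * S) → S * (px * a) * (py * b) ≤ Σ * (qx * qy) →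
    pe * px * py * n * (a * b) ≤ qe * tx * ty * qx * qy * Σ
  lower-bound-chain pe px py n a b U S Σ qe qx qy tx ty pen≤Uqe U≤txtyS S≤Σ = begin
      pe * px * py * n * (a * b)           ≡⟨ regroup₁ pe px py n a b ⟩
      pe * n * (px * a * (py * b))         ≤⟨ *-monoˡ-≤ (px * a * (py * b)) pen≤Uqe ⟩
      U * qe * (px * a * (py * b))         ≤⟨ *-monoˡ-≤ (px * a * (py * b)) (*-monoˡ-≤ qe U≤txtyS) ⟩
      tx * (ty * S) * qe * (px * a * (py * b)) ≡⟨ regroup₂ tx ty S qe (px * a) (py * b) ⟩
      tx * ty * qe * (S * (px * a) * (py * b)) ≤⟨ *-monoʳ-≤ (tx * ty * qe) S≤Σ ⟩
      tx * ty * qe * (Σ * (qx * qy))       ≡⟨ regroup₃ tx ty qe Σ qx qy ⟩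
      qe * tx * ty * qx * qy * Σ           ∎
    where
    open ≤-Reasoning
    regroup₁ : ∀ pe px py n a b → pe * px * py * n * (a * b) ≡ pe * n * (px * a * (py * b))
    regroup₁ = solve-∀
    regroup₂ : ∀ tx ty S qe x y → tx * (ty * S) * qe * (x * y) ≡ tx * ty * qe * (S * x * y)
    regroup₂ = solve-∀
    regroup₃ : ∀ tx ty qe Σ qx qy → tx * ty * qe * (Σ * (qx * qy)) ≡ qe * tx * ty * qx * qy * Σ
    regroup₃ = solve-∀

  absorb-overlaps : ∀ {P n A K Σ N B} → 1 ≤ P → P * n * A ≤ K * Σ → Σ ≤ N + B * A → 2 * K * B ≤ n →
    P * n * A ≤ 2 * K * N
  absorb-overlaps {P} {n} {A} {K} {Σ} {N} {B} 1≤P PnA≤KΣ Σ≤N+BA 2KB≤n =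
    absorb (P * n * A) K N (B * A) (≤-trans PnA≤KΣ (*-monoʳ-≤ K Σ≤N+BA)) (begin
      2 * (K * (B * A))   ≡⟨ regroup K B A ⟩
      2 * K * B * A       ≤⟨ *-monoˡ-≤ A 2KB≤n ⟩
      n * A               ≤⟨ *-monoˡ-≤ A (≤-trans (≤-reflexive (sym (*-identityʳ n))) (*-monoʳ-≤ n 1≤P)) ⟩
      n * P * A           ≡⟨ cong (_* A) (*-comm n P) ⟩
      P * n * A           ∎)
    where
    open ≤-Reasoning
    regroup : ∀ K B A → 2 * (K * (B * A)) ≡ 2 * K * B * A
    regroup = solve-∀

  ¬TPGraph0 : ¬ TPGraph 0
  ¬TPGraph0 H with w₁ H | w₂ H | w₁≢w₂ H
  ... | zero | zero | w₁≢w₂ = w₁≢w₂ refl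

  module Concatenation (r′ : ℕ) (H₀ : HVec (suc r′)) (Hs : List (HVec (suc r′)))
                       (K₀ : HVec (suc r′)) (Ks : List (HVec (suc r′)))
                       (βx βy ε : ℚ) (βx>0 : ℚ.Positive βx) (βy>0 : ℚ.Positive βy) (ε>0 : ℚ.Positive ε) where

    r : ℕ
    r = suc r′

    𝓗x 𝓗y : List⁺ (HVec r)
    𝓗x = H₀ ∷ Hs
    𝓗y = K₀ ∷ Ks

    tx ty : ℕ
    tx = List⁺.length 𝓗x
    ty = List⁺.length 𝓗y

    scale : ℕ
    scale = ↧ₙ ε * tx * ty * ↧ₙ βx * ↧ₙ βy

    maxOverlapPositions : ℕ
    maxOverlapPositions = ∑ (toList 𝓗x) tOf * (suc r * (∑ (toList 𝓗y) tOf * (suc r * 1)))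

    threshold : ℕ
    threshold = 2 * scale * maxOverlapPositions

    overlapPositions≤max : ∀ {H K} → H List.∈ toList 𝓗x → K List.∈ toList 𝓗y →
      overlapPositions H K ≤ maxOverlapPositions
    overlapPositions≤max H∈ K∈ =
      *-mono-≤ (∈⇒≤∑ tOf H∈) (*-monoʳ-≤ (suc r) (*-monoˡ-≤ (suc r * 1) (∈⇒≤∑ tOf K∈)))

    concat∈ : ∀ {H K} → H List.∈ toList 𝓗x → K List.∈ toList 𝓗y → concatH H K List.∈ toList (𝓗x ⊕ 𝓗y)
    concat∈ {H} {K} H∈ K∈ = ∈-++⁺ʳ (toList 𝓗x) (∈-++⁺ʳ (toList 𝓗y)
      (∈-concatMap⁺ (λ H′ → List.map (concatH H′) (toList 𝓗y)) (Any.map (λ { refl → ∈-map⁺ (concatH H) K∈ }) H∈)))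

    pe px py : ℕ
    pe = proj₁ (positive-numerator ε ε>0)
    px = proj₁ (positive-numerator βx βx>0)
    py = proj₁ (positive-numerator βy βy>0)

    ↥ε : ↥ ε ≡ ℤ.+ suc pe
    ↥ε = proj₂ (positive-numerator ε ε>0)
    ↥βx : ↥ βx ≡ ℤ.+ suc px
    ↥βx = proj₂ (positive-numerator βx βx>0)
    ↥βy : ↥ βy ≡ ℤ.+ suc py
    ↥βy = proj₂ (positive-numerator βy βy>0)

    module _ {n : ℕ} {{_ : NonZero n}} (G : Graph n) (x y : Fin n) (x≢y : x ≢ y) (n≥threshold : n ≥ threshold)
             (U : Subset n) (εn≤∣U∣ : ε ℚ.* fromℕ n ℚ.≤ fromℕ ∣ U ∣) {H K : HVec r}
             (H∈ : H List.∈ toList 𝓗x) (K∈ : K List.∈ toList 𝓗y)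
             (∣U∣≤ : ∣ U ∣ ≤ tx * (ty * Selection.hits {r} G βx βy x y H K)) where

      open Selection {r} G βx βy x y

      a b N Σ : ℕ
      a = n ^ (tOf H * r ∸ 1)
      b = n ^ (tOf K * r ∸ 1)
      N = numEmb G (concatH H K) x y
      Σ = ∑Fin n (λ z → numEmb G H x z * numEmb G K z y)

      hits-bound : hits H K * (suc px * a) * (suc py * b) ≤ Σ * (↧ₙ βx * ↧ₙ βy)
      hits-bound = ∑𝟙*≤∑* (allFin n) (through? H K) (λ z → numEmb G H x z) (λ z → numEmb G K z y)
        {suc px * a} {suc py * b} {↧ₙ βx} {↧ₙ βy}
        (λ z t → *fromℕ≤fromℕ⇒ βx a (numEmb G H x z) ↥βx (proj₁ (through?-sound H K z t)))
        (λ z t → *fromℕ≤fromℕ⇒ βy b (numEmb G K z y) ↥βy (proj₂ (through?-sound H K z t)))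

      bound : suc pe * suc px * suc py * n * (a * b) ≤ 2 * scale * N
      bound = absorb-overlaps {suc pe * suc px * suc py} {n} {a * b} {scale} {Σ} {N} {maxOverlapPositions} (s≤s z≤n)
        (lower-bound-chain (suc pe) (suc px) (suc py) n a b ∣ U ∣ (hits H K) Σ (↧ₙ ε) (↧ₙ βx) (↧ₙ βy) tx ty
          (*fromℕ≤fromℕ⇒ ε n ∣ U ∣ ↥ε εn≤∣U∣) ∣U∣≤ hits-bound)
        (≤-trans (∑N₁*N₂≤N+overlaps G H K x y x≢y) (+-monoʳ-≤ N (*-monoˡ-≤ (a * b) (overlapPositions≤max H∈ K∈))))
        n≥threshold

      exponent : n ^ (tOf (concatH H K) * r ∸ 1) ≡ a * b * n
      exponent = begin
          n ^ (r′ + (len H + suc (len K)) * r)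
        ≡⟨ cong (n ^_) (split r′ (len H) (len K)) ⟩
          n ^ ((r′ + len H * r) + (r′ + len K * r) + 1)
        ≡⟨ ^-distribˡ-+-* n ((r′ + len H * r) + (r′ + len K * r)) 1 ⟩
          n ^ ((r′ + len H * r) + (r′ + len K * r)) * (n * 1)
        ≡⟨ cong₂ _*_ (^-distribˡ-+-* n (r′ + len H * r) _) (*-identityʳ n) ⟩
          a * b * n
        ∎
        where
        open ≡-Reasoning
        split : ∀ r′ k l → r′ + (k + suc l) * suc r′ ≡ (r′ + k * suc r′) + (r′ + l * suc r′) + 1
        split = solve-∀

      x⇝y : Reachable G (concatH H K) (ε ℚ.* βx ℚ.* βy ℚ.* inv (2 * tx * ty)) x y
      x⇝y = subst (λ c → ε ℚ.* βx ℚ.* βy ℚ.* inv (2 * tx * ty) ℚ.* fromℕ c ℚ.≤ fromℕ N) (sym exponent)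
        (⇒*inv*fromℕ≤fromℕ ε βx βy (2 * tx * ty ∸ 1) (a * b * n) N
          ↥ε ↥βx ↥βy
          (≤-trans (≤-reflexive (regroup₁ (suc pe * suc px * suc py) n (a * b)))
            (≤-trans bound (≤-reflexive (regroup₂ N (↧ₙ ε) (↧ₙ βx) (↧ₙ βy) tx ty)))))
        where
        regroup₁ : ∀ P n A → P * 1 * (A * n) ≡ P * n * A
        regroup₁ = solve-∀
        regroup₂ : ∀ N e x y tx ty → 2 * (e * tx * ty * x * y) * N ≡ N * (e * x * y * (2 * tx * ty) * 1)
        regroup₂ = solve-∀

    concat-reachable : (n : ℕ) → n ≥ threshold → (G : Graph n) (x y : Fin n) → x ≢ y →
      (U : Subset n) → ε ℚ.* fromℕ n ℚ.≤ fromℕ ∣ U ∣ →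
      ((z : Fin n) → z ∈ U → ReachableSet G 𝓗x βx x z × ReachableSet G 𝓗y βy z y) →
      ReachableSet G (𝓗x ⊕ 𝓗y) (ε ℚ.* βx ℚ.* βy ℚ.* inv (2 * tx * ty)) x y
    concat-reachable zero _ _ ()
    concat-reachable n@(suc _) n≥threshold G x y x≢y U εn≤∣U∣ reach =
      let H , K , H∈ , K∈ , ∣U∣≤ = Selection.popular-pair G βx βy x y 𝓗x 𝓗y U reach
      in concatH H K , concat∈ H∈ K∈ , x⇝y G x y x≢y n≥threshold U εn≤∣U∣ H∈ K∈ ∣U∣≤

open Reachability
open import Data.Nat using (ℕ; _≥_; _*_; zero; suc)
open import Data.Rational using (ℚ; Positive; _≤_)
open import Data.Fin using (Fin; zero)
open import Data.Fin.Subset using (Subset; _∈_; ∣_∣)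
open import Data.List.NonEmpty using (List⁺; length; _∷_)
open import Data.Product using (Σ; _×_; _,_)
open import Data.Empty using (⊥-elim)
open import Relation.Binary.PropositionalEquality using (_≢_)
import Data.Rational as Q

lemma6p10 : (r : ℕ) (𝓗x 𝓗y : List⁺ (HVec r)) (βx βy ε : ℚ) →
    Positive βx → Positive βy → Positive ε →
    Σ ℕ λ n₀ → (n : ℕ) → n ≥ n₀ → (G : Graph n) (x y : Fin n) → x ≢ y →
    (U : Subset n) → ε Q.* fromℕ n ≤ fromℕ ∣ U ∣ →
    ((z : Fin n) → z ∈ U → ReachableSet G 𝓗x βx x z × ReachableSet G 𝓗y βy z y) →
    ReachableSet G (𝓗x ⊕ 𝓗y)
      (ε Q.* βx Q.* βy Q.* inv (2 * length 𝓗x * length 𝓗y)) x y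
lemma6p10 zero     (H ∷ _)  _ _ _ _ _ _ _ = ⊥-elim (¬TPGraph0 (graphs H zero))
lemma6p10 (suc r′) (H₀ ∷ Hs) (K₀ ∷ Ks) βx βy ε βx>0 βy>0 ε>0 = threshold , concat-reachable
  where open Concatenation r′ H₀ Hs K₀ Ks βx βy ε βx>0 βy>0 ε>0
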